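{- Let $V$ be an $n$-dimensional vector space over $\mathbb{F}_q$, let $k$ be a positive integer with $k\le n/2$, and let $\mathcal{S}^*$ be a family of $s$ subspaces of $V$ of codimension $k$, with $s\ge 2$, such that for some integer $d\ge2$: (1) for every $v\in V\setminus\{0\}$, $|\{M\in\mathcal{S}^*: v\in M\}|\in\{0,d\}$, with both values occurring; and (2) $\dim(M\cap M^*)=n-2k$ for all distinct $M,M^*\in\mathcal{S}^*$. Let $\mathcal{Y}$ be the set of one-dimensional subspaces $U$ of $V$ with $|\{M\in\mathcal{S}^*: U\subseteq M\}|=d$. Then $\mathcal{Y}$ is a projective $(N,n,h_1,h_2)$ set, where \[ N=\frac{s}{d}\begin{bmatrix} n-k\end{bmatrix}_q,\quad h_1=\frac1d\begin{bmatrix} n-k\end{bmatrix}_q+\frac{s-1}{d}\begin{bmatrix} n-k-1\end{bmatrix}_q,\quad h_2=\frac sd\begin{bmatrix} n-k-1\end{bmatrix}_q. \]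
   Context: For an integer $m\ge0$, $\begin{bmatrix} m\end{bmatrix}_q=\frac{q^m-1}{q-1}$. A projective $(N,K,h_1,h_2)$ set is a proper, non-empty set of $N$ points of the projective space $PG(K-1,q)$ (i.e. one-dimensional subspaces of a $K$-dimensional $\mathbb{F}_q$-vector space) such that every hyperplane contains either exactly $h_1$ or exactly $h_2$ of these points. -}

module Defs where

open import Data.Nat as ℕ using (ℕ; zero; suc)
open import Data.Fin as Fin using (Fin)
open import Data.Vec using (Vec; []; _∷_; zipWith; replicate; map)
open import Data.List as List using (List; []; _∷_; length; filter; concatMap; allFin)
open import Data.List.Membership.Propositional using (_∈_)
open import Data.List.Relation.Unary.Unique.Propositional using (Unique)
open import Data.Product using (Σ; Σ-syntax; _×_; ∃; _,_)
open import Data.Sum using (_⊎_)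
open import Data.Empty using (⊥)
open import Relation.Nullary using (¬_; Dec; yes; no)
open import Relation.Nullary.Decidable using (_×-dec_; _⊎-dec_)
open import Relation.Binary.PropositionalEquality using (_≡_; _≢_)
open import Algebra.Core using (Op₁; Op₂)
import Algebra.Structures as AS

-- Gaussian q-number [m]_q = (q^m - 1)/(q - 1) = q^(m-1) + ... + q + 1
[_]_ : ℕ → ℕ → ℕ
[ zero ] q = 0
[ suc m ] q = q ℕ.^ m ℕ.+ [ m ] q

record FiniteField : Set₁ where
  field
    Carrier : Set
    _+_ _*_ : Op₂ Carrier
    -_      : Op₁ Carrier
    0# 1#   : Carrier
    isCommutativeRing : AS.IsCommutativeRing {A = Carrier} _≡_ _+_ _*_ -_ 0# 1#
    0≢1     : 0# ≢ 1#
    inverse : ∀ x → x ≢ 0# → Σ[ y ∈ Carrier ] x * y ≡ 1#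
    _≟_     : (x y : Carrier) → Dec (x ≡ y)
    elements : List Carrier
    elements-complete : ∀ x → x ∈ elements
    elements-unique   : Unique elements

  order : ℕ
  order = length elements

module Geometry (F : FiniteField) where
  open FiniteField F

  V : ℕ → Set
  V n = Vec Carrier n

  0v : ∀ {n} → V n
  0v = replicate _ 0#

  _⊕_ : ∀ {n} → V n → V n → V n
  _⊕_ = zipWith _+_

  _·_ : ∀ {n} → Carrier → V n → V n
  c · v = map (c *_) v

  lincomb : ∀ {n m} → (Fin m → Carrier) → (Fin m → V n) → V n
  lincomb {m = zero}  c b = 0v
  lincomb {m = suc m} c b =
    (c Fin.zero · b Fin.zero) ⊕ lincomb (λ i → c (Fin.suc i)) (λ i → b (Fin.suc i))

  record Subspace (n : ℕ) : Set₁ where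
    field
      mem  : V n → Set
      dec  : ∀ v → Dec (mem v)
      0∈   : mem 0v
      ⊕∈   : ∀ {u v} → mem u → mem v → mem (u ⊕ v)
      ·∈   : ∀ c {v} → mem v → mem (c · v)
  open Subspace public

  _∩_ : ∀ {n} → Subspace n → Subspace n → Subspace n
  M ∩ N = record
    { mem = λ v → mem M v × mem N v
    ; dec = λ v → dec M v ×-dec dec N v
    ; 0∈  = 0∈ M , 0∈ N
    ; ⊕∈  = λ { (a , b) (c , d) → ⊕∈ M a c , ⊕∈ N b d }
    ; ·∈  = λ c → λ { (a , b) → ·∈ M c a , ·∈ N c b }
    }

  LinIndep : ∀ {n m} → (Fin m → V n) → Set
  LinIndep b = ∀ c → lincomb c b ≡ 0v → ∀ i → c i ≡ 0#

  HasDim : ∀ {n} → Subspace n → ℕ → Set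
  HasDim {n} M m =
    Σ[ b ∈ (Fin m → V n) ]
      ((∀ i → mem M (b i)) × LinIndep b ×
       (∀ v → mem M v → Σ[ c ∈ (Fin m → Carrier) ] v ≡ lincomb c b))

  IsHyperplane : ∀ {n} → Subspace n → Set
  IsHyperplane {n} H = HasDim H (n ℕ.∸ 1)

  -- Points of PG(n-1,q) (one-dimensional subspaces <v>) are represented by
  -- their unique normalised generator: v ≠ 0 whose first nonzero entry is 1.
  Normalised : ∀ {n} → V n → Set
  Normalised []      = ⊥
  Normalised (x ∷ v) = (x ≡ 1#) ⊎ (x ≡ 0# × Normalised v)

  normalised? : ∀ {n} (v : V n) → Dec (Normalised v)
  normalised? []      = no (λ ())
  normalised? (x ∷ v) = (x ≟ 1#) ⊎-dec ((x ≟ 0#) ×-dec normalised? v)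

  allVecs : (n : ℕ) → List (V n)
  allVecs zero    = [] ∷ []
  allVecs (suc n) = concatMap (λ x → List.map (x ∷_) (allVecs n)) elements

  #points : ∀ {n} {P : V n → Set} → (∀ v → Dec (P v)) → ℕ
  #points {n} P? = length (filter (λ v → normalised? v ×-dec P? v) (allVecs n))

  -- for a family S of s subspaces: |{ i : <v> ⊆ S i }| = |{ i : v ∈ S i }|
  mult : ∀ {n s} → (Fin s → Subspace n) → V n → ℕ
  mult {s = s} S v = length (filter (λ i → dec (S i) v) (allFin s))

  InY : ∀ {n s} → (Fin s → Subspace n) → ℕ → V n → Set
  InY S d v = mult S v ≡ d

  InY? : ∀ {n s} (S : Fin s → Subspace n) (d : ℕ) → ∀ v → Dec (InY S d v)
  InY? S d v = mult S v ℕ.≟ d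

  IsProjectiveSet : ∀ {n} {P : V n → Set} → (∀ v → Dec (P v)) → ℕ → ℕ → ℕ → Set₁
  IsProjectiveSet {n} {P} P? N h₁ h₂ =
    (Σ[ v ∈ V n ] Normalised v × P v) ×
    (Σ[ v ∈ V n ] Normalised v × ¬ P v) ×
    #points P? ≡ N ×
    (∀ (H : Subspace n) → IsHyperplane H →
       let PH? = λ v → P? v ×-dec dec H v in
       #points PH? ≡ h₁ ⊎ #points PH? ≡ h₂)

{-# OPTIONS --safe #-}
-- Double count incidences between points and members of the family: a point of Y lies in exactly d
-- of the S i and every other point in none, so d · |Y ∩ W| = Σ_i |S i ∩ W| for every set of points W.
-- For W the whole space this gives d N = s [n-k]. A hyperplane H meets S i in [n-k-1] points, plus
-- q^(n-k-1) more if S i ⊆ H, and contains at most one S i, because two of them already span V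
-- (2(n-k) - (n-2k) = n). Hence d · |Y ∩ H| = s [n-k-1] + t q^(n-k-1) with t ∈ {0, 1}. Both values
-- occur: t = 1 for a hyperplane through some S i, and t = 0 for some hyperplane since, counting
-- annihilators, at most s [k] hyperplanes contain a member while properness of Y forces s [k] < [n].
module Submission where

open import Defs

module Counting where

  open import Data.Nat using (ℕ; suc; _+_; _*_; _≤_; _<_; z≤n; s≤s)
  open import Data.Nat.Properties
  open import Data.List using (List; []; _∷_; length; filter; map; _++_; cartesianProduct; allFin)
  open import Data.Fin using (Fin)
  open import Data.List.Properties
    using (length-map; length-tabulate; length-++; length-filter; filter-all; filter-none; filter-some; filter-complete; filter-++)
  open import Data.List.Membership.Propositional using (_∈_; find; lose)
  open import Data.List.Membership.Propositional.Properties
    using (∈-filter⁺; ∈-filter⁻; ∈-map∘filter⁺; ∈-map∘filter⁻; ∈-cartesianProduct⁺; ∈-allFin)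
  open import Data.List.Relation.Unary.Any using (here; there; any?)
  import Data.List.Relation.Unary.All as All
  open import Data.List.Relation.Unary.AllPairs using ([]; _∷_)
  import Data.List.Relation.Unary.All.Properties as All
  open import Algebra.Properties.CommutativeSemigroup +-commutativeSemigroup using () renaming (interchange to +-interchange)
  open import Data.List.Relation.Unary.Unique.Propositional using (Unique)
  import Data.List.Relation.Unary.Unique.Propositional.Properties as Unique
  open import Data.Product using (Σ-syntax; ∃; ∃-syntax; _×_; _,_; proj₁; proj₂)
  open import Function using (_∘_; id)
  open import Relation.Nullary using (¬_; Dec; yes; no; contradiction)
  open import Relation.Nullary.Decidable using (_×-dec_; ¬?)
  open import Relation.Unary using (Decidable)
  open import Relation.Binary.PropositionalEquality

  private variable
    A B : Set
    P Q : A → Set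

  record Enumeration (A : Set) : Set where
    field
      list     : List A
      unique   : Unique list
      complete : ∀ a → a ∈ list
  open Enumeration public

  _×ᴱ_ : Enumeration A → Enumeration B → Enumeration (A × B)
  EA ×ᴱ EB = record
    { list     = cartesianProduct (list EA) (list EB)
    ; unique   = Unique.cartesianProduct⁺ (unique EA) (unique EB)
    ; complete = λ (a , b) → ∈-cartesianProduct⁺ (complete EA a) (complete EB b)
    }

  fins : ∀ n → Enumeration (Fin n)
  fins n = record { list = allFin n ; unique = Unique.allFin⁺ n ; complete = ∈-allFin }

  length-allFin : ∀ n → length (allFin n) ≡ n
  length-allFin n = length-tabulate {n = n} id

  ∃? : {P : A → Set} → Enumeration A → Decidable P → Dec (∃ P)
  ∃? E P? with any? P? (list E)
  ... | yes p = yes (let (a , _ , pa) = find p in a , pa)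
  ... | no ¬p = no λ (a , pa) → ¬p (lose (complete E a) pa)

  ∀? : {P : A → Set} → Enumeration A → Decidable P → Dec (∀ a → P a)
  ∀? E P? with All.all? P? (list E)
  ... | yes p = yes λ a → All.lookup p (complete E a)
  ... | no ¬p = no λ p → ¬p (All.tabulate (λ {a} _ → p a))

  indicator : {X : Set} → Dec X → ℕ
  indicator (yes _) = 1
  indicator (no _)  = 0

  count : {P : A → Set} → Decidable P → List A → ℕ
  count P? xs = length (filter P? xs)

  count-∷ : (P? : Decidable P) (x : A) (xs : List A) →
            count P? (x ∷ xs) ≡ indicator (P? x) + count P? xs
  count-∷ P? x xs with P? x
  ... | yes _ = refl
  ... | no _  = refl

  count-mono : (P? : Decidable P) (Q? : Decidable Q) (xs : List A) →
               (∀ {x} → x ∈ xs → P x → Q x) → count P? xs ≤ count Q? xs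
  count-mono P? Q? [] _ = z≤n
  count-mono P? Q? (x ∷ xs) P⇒Q with P? x | Q? x | count-mono P? Q? xs (P⇒Q ∘ there)
  ... | yes _  | yes _  | ih = s≤s ih
  ... | yes px | no ¬qx | _  = contradiction (P⇒Q (here refl) px) ¬qx
  ... | no _   | yes _  | ih = m≤n⇒m≤1+n ih
  ... | no _   | no _   | ih = ih

  count-cong : (P? : Decidable P) (Q? : Decidable Q) (xs : List A) →
               (∀ {x} → x ∈ xs → P x → Q x) → (∀ {x} → x ∈ xs → Q x → P x) →
               count P? xs ≡ count Q? xs
  count-cong P? Q? xs P⇒Q Q⇒P = ≤-antisym (count-mono P? Q? xs P⇒Q) (count-mono Q? P? xs Q⇒P)

  count-none : (P? : Decidable P) (xs : List A) → (∀ {x} → x ∈ xs → ¬ P x) → count P? xs ≡ 0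
  count-none P? xs ¬P = cong length (filter-none P? (All.tabulate ¬P))

  count-all : (P? : Decidable P) (xs : List A) → (∀ {x} → x ∈ xs → P x) → count P? xs ≡ length xs
  count-all P? xs all-P = cong length (filter-all P? (All.tabulate all-P))

  1≤count : (P? : Decidable P) {xs : List A} {x : A} → x ∈ xs → P x → 1 ≤ count P? xs
  1≤count P? x∈xs px = filter-some P? (lose x∈xs px)

  count≥length⇒all : (P? : Decidable P) (xs : List A) → length xs ≤ count P? xs →
                     ∀ {x} → x ∈ xs → P x
  count≥length⇒all P? xs ≥length x∈xs =
    proj₂ (∈-filter⁻ P? {xs = xs} (subst (_ ∈_) (sym (filter-complete P? (≤-antisym (length-filter P? xs) ≥length))) x∈xs))

  count≤1 : (P? : Decidable P) {xs : List A} → Unique xs →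
            (∀ {x y} → x ∈ xs → y ∈ xs → P x → P y → x ≡ y) → count P? xs ≤ 1
  count≤1 P? {[]} _ _ = z≤n
  count≤1 P? {x ∷ xs} (x∉xs ∷ unique-xs) P-unique with P? x
  ... | no _   = count≤1 P? unique-xs λ y∈ z∈ → P-unique (there y∈) (there z∈)
  ... | yes px = s≤s (≤-reflexive (count-none P? xs λ y∈ py →
                   All.lookup x∉xs y∈ (P-unique (here refl) (there y∈) px py)))

  count-split : (P? : Decidable P) (Q? : Decidable Q) (xs : List A) →
                count P? xs ≡ count (λ x → P? x ×-dec Q? x) xs + count (λ x → P? x ×-dec ¬? (Q? x)) xs
  count-split P? Q? [] = refl
  count-split P? Q? (x ∷ xs) with P? x | Q? x | count-split P? Q? xs
  ... | yes _ | yes _ | ih = cong suc ih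
  ... | yes _ | no _  | ih = trans (cong suc ih) (sym (+-suc _ _))
  ... | no _  | yes _ | ih = ih
  ... | no _  | no _  | ih = ih

  count-<  : (P? : Decidable P) (Q? : Decidable Q) (xs : List A) →
             (∀ {x} → x ∈ xs → P x → Q x) → ∀ {x} → x ∈ xs → Q x → ¬ P x →
             count P? xs < count Q? xs
  count-< P? Q? xs P⇒Q x∈xs qx ¬px = begin-strict
    count P? xs                    <⟨ m<m+n _ (1≤count _ x∈xs (qx , ¬px)) ⟩
    count P? xs + count Q∖P? xs    ≡⟨ cong (_+ count Q∖P? xs) (count-cong P? Q∩P? xs (λ x∈ px → P⇒Q x∈ px , px) (λ _ → proj₂)) ⟩
    count Q∩P? xs + count Q∖P? xs  ≡⟨ count-split Q? P? xs ⟨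
    count Q? xs                    ∎
    where
    open ≤-Reasoning
    Q∩P? = λ x → Q? x ×-dec P? x
    Q∖P? = λ x → Q? x ×-dec ¬? (P? x)

  count≡1+count≢ : (P? : Decidable P) (_≟_ : (x y : A) → Dec (x ≡ y)) {xs : List A} → Unique xs →
                   ∀ {x} → x ∈ xs → P x → count P? xs ≡ suc (count (λ y → P? y ×-dec ¬? (y ≟ x)) xs)
  count≡1+count≢ P? _≟_ {xs} unique-xs {x} x∈xs px = trans (count-split P? (_≟ x) xs)
    (cong (_+ count (λ y → P? y ×-dec ¬? (y ≟ x)) xs)
    (≤-antisym (count≤1 (λ y → P? y ×-dec (y ≟ x)) unique-xs (λ _ _ (_ , y≡x) (_ , z≡x) → trans y≡x (sym z≡x)))
               (1≤count (λ y → P? y ×-dec (y ≟ x)) x∈xs (px , refl))))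

  private
    remove : {x : A} {ys : List A} → x ∈ ys →
             Σ[ zs ∈ List A ] (length ys ≡ suc (length zs) × (∀ {y} → y ∈ ys → y ≢ x → y ∈ zs))
    remove {ys = _ ∷ ys} (here refl) = ys , refl , λ where
      (here refl) y≢x → contradiction refl y≢x
      (there y∈)  _   → y∈
    remove {ys = y ∷ _} (there x∈) with zs , eq , sub ← remove x∈ = y ∷ zs , cong suc eq , λ where
      (here refl) _   → here refl
      (there z∈)  z≢x → there (sub z∈ z≢x)

  unique⊆⇒length≤ : {xs ys : List A} → Unique xs → (∀ {x} → x ∈ xs → x ∈ ys) → length xs ≤ length ys
  unique⊆⇒length≤ {xs = []} _ _ = z≤n
  unique⊆⇒length≤ {xs = x ∷ xs} (x∉xs ∷ unique-xs) xs⊆ys with zs , eq , sub ← remove (xs⊆ys (here refl)) =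
    subst (suc (length xs) ≤_) (sym eq) (s≤s (unique⊆⇒length≤ unique-xs λ y∈ →
      sub (xs⊆ys (there y∈)) λ y≡x → All.lookup x∉xs y∈ (sym y≡x)))

  InjectiveOn : (A → Set) → (A → B) → Set
  InjectiveOn P f = ∀ {a a′} → P a → P a′ → f a ≡ f a′ → a ≡ a′

  SurjectiveOnto : (A → Set) → (B → Set) → (A → B) → Set
  SurjectiveOnto P Q f = ∀ {b} → Q b → ∃[ a ] P a × f a ≡ b

  unique-map : (f : A → B) {xs : List A} → Unique xs → InjectiveOn (_∈ xs) f → Unique (map f xs)
  unique-map f {[]} _ _ = []
  unique-map f {x ∷ xs} (x∉xs ∷ unique-xs) f-inj =
    All.map⁺ (All.tabulate λ y∈ fx≡fy → All.lookup x∉xs y∈ (f-inj (here refl) (there y∈) fx≡fy))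
    ∷ unique-map f unique-xs λ y∈ z∈ → f-inj (there y∈) (there z∈)

  injection⇒count≤ : (P? : Decidable P) (Q? : Decidable Q) {xs : List A} (EB : Enumeration B) →
                     Unique xs → (f : A → B) → (∀ {a} → P a → Q (f a)) → InjectiveOn P f →
                     count P? xs ≤ count Q? (list EB)
  injection⇒count≤ P? Q? {xs} EB unique-xs f P⇒Qf f-inj =
    subst (_≤ count Q? (list EB)) (length-map f (filter P? xs)) (unique⊆⇒length≤
      (unique-map f (Unique.filter⁺ P? unique-xs) λ a∈ a′∈ →
        f-inj (proj₂ (∈-filter⁻ P? {xs = xs} a∈)) (proj₂ (∈-filter⁻ P? {xs = xs} a′∈)))
      λ b∈ → let (a , _ , b≡fa , pa) = ∈-map∘filter⁻ f P? {xs = xs} b∈ in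
        subst (_∈ filter Q? (list EB)) (sym b≡fa) (∈-filter⁺ Q? (complete EB (f a)) (P⇒Qf pa)))

  surjection⇒count≥ : (P? : Decidable P) (Q? : Decidable Q) (EA : Enumeration A) {ys : List B} →
                      Unique ys → (f : A → B) → SurjectiveOnto P Q f →
                      count Q? ys ≤ count P? (list EA)
  surjection⇒count≥ P? Q? EA {ys} unique-ys f f-onto =
    subst (count Q? ys ≤_) (length-map f (filter P? (list EA))) (unique⊆⇒length≤
      (Unique.filter⁺ Q? unique-ys)
      λ b∈ → let (a , pa , fa≡b) = f-onto (proj₂ (∈-filter⁻ Q? {xs = ys} b∈)) in
        ∈-map∘filter⁺ f P? (a , complete EA a , sym fa≡b , pa))

  bijection⇒count≡ : (P? : Decidable P) (Q? : Decidable Q) (EA : Enumeration A) (EB : Enumeration B) →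
                     (f : A → B) → (∀ {a} → P a → Q (f a)) → InjectiveOn P f → SurjectiveOnto P Q f →
                     count P? (list EA) ≡ count Q? (list EB)
  bijection⇒count≡ P? Q? EA EB f P⇒Qf f-inj f-onto = ≤-antisym
    (injection⇒count≤ P? Q? EB (unique EA) f P⇒Qf f-inj)
    (surjection⇒count≥ P? Q? EA (unique EB) f f-onto)

  count-++ : (P? : Decidable P) (xs ys : List A) → count P? (xs ++ ys) ≡ count P? xs + count P? ys
  count-++ P? xs ys = trans (cong length (filter-++ P? xs ys)) (length-++ (filter P? xs))

  count-map : (P? : Decidable P) (f : B → A) (xs : List B) → count P? (map f xs) ≡ count (P? ∘ f) xs
  count-map P? f [] = refl
  count-map P? f (x ∷ xs) = begin
    count P? (f x ∷ map f xs)                     ≡⟨ count-∷ P? (f x) (map f xs) ⟩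
    indicator (P? (f x)) + count P? (map f xs)     ≡⟨ cong (indicator (P? (f x)) +_) (count-map P? f xs) ⟩
    indicator (P? (f x)) + count (P? ∘ f) xs       ≡⟨ count-∷ (P? ∘ f) x xs ⟨
    count (P? ∘ f) (x ∷ xs)                       ∎
    where open ≡-Reasoning

  _⊗?_ : Decidable P → Decidable Q → Decidable (λ (p : A × B) → P (proj₁ p) × Q (proj₂ p))
  (P? ⊗? Q?) (a , b) = P? a ×-dec Q? b

  count-cartesianProduct : (P? : Decidable P) (Q? : Decidable Q) (xs : List A) (ys : List B) →
    count (P? ⊗? Q?) (cartesianProduct xs ys) ≡ count P? xs * count Q? ys
  count-cartesianProduct P? Q? [] ys = refl
  count-cartesianProduct P? Q? (x ∷ xs) ys = begin
    count PQ? (map (x ,_) ys ++ cartesianProduct xs ys)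
      ≡⟨ count-++ PQ? (map (x ,_) ys) (cartesianProduct xs ys) ⟩
    count PQ? (map (x ,_) ys) + count PQ? (cartesianProduct xs ys)
      ≡⟨ cong₂ _+_ (trans (count-map PQ? (x ,_) ys) (row (P? x))) (count-cartesianProduct P? Q? xs ys) ⟩
    indicator (P? x) * count Q? ys + count P? xs * count Q? ys
      ≡⟨ *-distribʳ-+ (count Q? ys) (indicator (P? x)) (count P? xs) ⟨
    (indicator (P? x) + count P? xs) * count Q? ys
      ≡⟨ cong (_* count Q? ys) (count-∷ P? x xs) ⟨
    count P? (x ∷ xs) * count Q? ys ∎
    where
    open ≡-Reasoning
    PQ? = P? ⊗? Q?
    row : {X : Set} (px? : Dec X) → count (λ y → px? ×-dec Q? y) ys ≡ indicator px? * count Q? ys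
    row (yes px) = trans (count-cong _ Q? ys (λ _ → proj₂) (λ _ qy → px , qy)) (sym (+-identityʳ _))
    row (no ¬px) = count-none _ ys λ _ (px , _) → ¬px px

  ∑ : List A → (A → ℕ) → ℕ
  ∑ []       f = 0
  ∑ (x ∷ xs) f = f x + ∑ xs f

  syntax ∑ xs (λ x → e) = ∑[ x ∈ xs ] e

  ∑-cong : {f g : A → ℕ} (xs : List A) → (∀ {x} → x ∈ xs → f x ≡ g x) → ∑ xs f ≡ ∑ xs g
  ∑-cong []       _   = refl
  ∑-cong (x ∷ xs) f≡g = cong₂ _+_ (f≡g (here refl)) (∑-cong xs (f≡g ∘ there))

  ∑-mono : {f g : A → ℕ} (xs : List A) → (∀ {x} → x ∈ xs → f x ≤ g x) → ∑ xs f ≤ ∑ xs g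
  ∑-mono []       _   = z≤n
  ∑-mono (x ∷ xs) f≤g = +-mono-≤ (f≤g (here refl)) (∑-mono xs (f≤g ∘ there))

  ∑-+ : (f g : A → ℕ) (xs : List A) → ∑[ x ∈ xs ] (f x + g x) ≡ ∑ xs f + ∑ xs g
  ∑-+ f g []       = refl
  ∑-+ f g (x ∷ xs) = trans (cong (f x + g x +_) (∑-+ f g xs)) (+-interchange (f x) (g x) (∑ xs f) (∑ xs g))

  ∑-*ˡ : (c : ℕ) (f : A → ℕ) (xs : List A) → ∑[ x ∈ xs ] (c * f x) ≡ c * ∑ xs f
  ∑-*ˡ c f []       = sym (*-zeroʳ c)
  ∑-*ˡ c f (x ∷ xs) = trans (cong (c * f x +_) (∑-*ˡ c f xs)) (sym (*-distribˡ-+ c (f x) (∑ xs f)))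

  ∑-const : (c : ℕ) (xs : List A) → ∑[ _ ∈ xs ] c ≡ length xs * c
  ∑-const c []       = refl
  ∑-const c (_ ∷ xs) = cong (c +_) (∑-const c xs)

  ∑-indicator : (P? : Decidable P) (xs : List A) → ∑[ x ∈ xs ] indicator (P? x) ≡ count P? xs
  ∑-indicator P? []       = refl
  ∑-indicator P? (x ∷ xs) = trans (cong (indicator (P? x) +_) (∑-indicator P? xs)) (sym (count-∷ P? x xs))

  ∑-affine : (P? : Decidable P) (c e : ℕ) (xs : List A) →
             ∑[ x ∈ xs ] (c + indicator (P? x) * e) ≡ length xs * c + count P? xs * e
  ∑-affine P? c e xs = begin
    ∑[ x ∈ xs ] (c + indicator (P? x) * e)           ≡⟨ ∑-+ (λ _ → c) (λ x → indicator (P? x) * e) xs ⟩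
    ∑[ _ ∈ xs ] c + ∑[ x ∈ xs ] (indicator (P? x) * e)
      ≡⟨ cong₂ _+_ (∑-const c xs) (∑-cong xs λ {x} _ → *-comm (indicator (P? x)) e) ⟩
    length xs * c + ∑[ x ∈ xs ] (e * indicator (P? x)) ≡⟨ cong (length xs * c +_) (∑-*ˡ e (indicator ∘ P?) xs) ⟩
    length xs * c + e * ∑[ x ∈ xs ] indicator (P? x)   ≡⟨ cong (λ t → length xs * c + e * t) (∑-indicator P? xs) ⟩
    length xs * c + e * count P? xs                    ≡⟨ cong (length xs * c +_) (*-comm e (count P? xs)) ⟩
    length xs * c + count P? xs * e                    ∎
    where open ≡-Reasoning

  ∑-count-swap : {R : A → B → Set} (R? : ∀ a b → Dec (R a b)) (xs : List A) (ys : List B) →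
                 ∑[ a ∈ xs ] count (R? a) ys ≡ ∑[ b ∈ ys ] count (λ a → R? a b) xs
  ∑-count-swap R? [] ys = sym (trans (∑-const 0 ys) (*-zeroʳ (length ys)))
  ∑-count-swap R? (a ∷ xs) ys = begin
    count (R? a) ys + ∑[ a ∈ xs ] count (R? a) ys
      ≡⟨ cong₂ _+_ (∑-indicator (R? a) ys) (sym (∑-count-swap R? xs ys)) ⟨
    ∑[ b ∈ ys ] indicator (R? a b) + ∑[ b ∈ ys ] count (λ a → R? a b) xs
      ≡⟨ ∑-+ (λ b → indicator (R? a b)) (λ b → count (λ a → R? a b) xs) ys ⟨
    ∑[ b ∈ ys ] (indicator (R? a b) + count (λ a → R? a b) xs)
      ≡⟨ ∑-cong ys (λ {b} _ → count-∷ (λ a → R? a b) a xs) ⟨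
    ∑[ b ∈ ys ] count (λ a → R? a b) (a ∷ xs) ∎
    where open ≡-Reasoning

  count-any≤∑ : {R : A → B → Set} (R? : ∀ a b → Dec (R a b)) (xs : List A) (ys : List B) →
                count (λ b → any? (λ a → R? a b) xs) ys ≤ ∑[ a ∈ xs ] count (R? a) ys
  count-any≤∑ R? xs ys = begin
    count (λ b → any? (λ a → R? a b) xs) ys             ≡⟨ ∑-indicator (λ b → any? (λ a → R? a b) xs) ys ⟨
    ∑[ b ∈ ys ] indicator (any? (λ a → R? a b) xs)      ≤⟨ ∑-mono ys (λ {b} _ → indicator-any≤count b) ⟩
    ∑[ b ∈ ys ] count (λ a → R? a b) xs                 ≡⟨ ∑-count-swap R? xs ys ⟨
    ∑[ a ∈ xs ] count (R? a) ys                         ∎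
    where
    open ≤-Reasoning
    indicator-any≤count : ∀ b → indicator (any? (λ a → R? a b) xs) ≤ count (λ a → R? a b) xs
    indicator-any≤count b with any? (λ a → R? a b) xs
    ... | yes some = let (_ , a∈ , r) = find some in 1≤count (λ a → R? a b) a∈ r
    ... | no _     = z≤n

  count-fibres : (P? : Decidable P) (f : A → B) (_≟_ : (b b′ : B) → Dec (b ≡ b′)) (EB : Enumeration B) (xs : List A) →
                 count P? xs ≡ ∑[ b ∈ list EB ] count (λ a → P? a ×-dec (f a ≟ b)) xs
  count-fibres P? f _≟_ EB xs = begin
    count P? xs                                               ≡⟨ ∑-indicator P? xs ⟨
    ∑[ a ∈ xs ] indicator (P? a)                              ≡⟨ ∑-cong xs (λ {a} _ → fibre-count a) ⟨
    ∑[ a ∈ xs ] count (λ b → P? a ×-dec (f a ≟ b)) (list EB)   ≡⟨ ∑-count-swap (λ a b → P? a ×-dec (f a ≟ b)) xs (list EB) ⟩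
    ∑[ b ∈ list EB ] count (λ a → P? a ×-dec (f a ≟ b)) xs     ∎
    where
    open ≡-Reasoning
    fibre-count : ∀ a → count (λ b → P? a ×-dec (f a ≟ b)) (list EB) ≡ indicator (P? a)
    fibre-count a with P? a
    ... | no ¬pa = count-none _ (list EB) λ _ (pa , _) → ¬pa pa
    ... | yes pa = ≤-antisym (count≤1 _ (unique EB) λ _ _ (_ , fa≡b) (_ , fa≡b′) → trans (sym fa≡b) fa≡b′)
                             (1≤count (λ b → yes pa ×-dec (f a ≟ b)) (complete EB (f a)) (pa , refl))


module QNumbers where

  open import Data.Nat
  open import Data.Nat.Properties
  open import Data.Nat.Tactic.RingSolver using (solve-∀)
  open import Relation.Nullary using (yes; no; contradiction)
  open import Relation.Binary.PropositionalEquality hiding ([_])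

  [m]-geometric : ∀ p m → suc (p * [ m ] (suc p)) ≡ suc p ^ m
  [m]-geometric p zero    = cong suc (*-zeroʳ p)
  [m]-geometric p (suc m) = begin
    suc (p * (suc p ^ m + [ m ] (suc p)))         ≡⟨ cong suc (*-distribˡ-+ p (suc p ^ m) ([ m ] (suc p))) ⟩
    suc (p * suc p ^ m + p * [ m ] (suc p))       ≡⟨ +-suc (p * suc p ^ m) _ ⟨
    p * suc p ^ m + suc (p * [ m ] (suc p))       ≡⟨ cong (p * suc p ^ m +_) ([m]-geometric p m) ⟩
    p * suc p ^ m + suc p ^ m                     ≡⟨ +-comm (p * suc p ^ m) _ ⟩
    suc p * suc p ^ m                             ∎
    where open ≡-Reasoning

  [m+a] : ∀ q m a → [ m + a ] q ≡ q ^ m * [ a ] q + [ m ] q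
  [m+a] q m zero rewrite +-identityʳ m | *-zeroʳ (q ^ m) = refl
  [m+a] q m (suc a) = begin
    [ m + suc a ] q                              ≡⟨ cong (λ t → [ t ] q) (+-suc m a) ⟩
    q ^ (m + a) + [ m + a ] q                    ≡⟨ cong₂ _+_ (^-distribˡ-+-* q m a) ([m+a] q m a) ⟩
    q ^ m * q ^ a + (q ^ m * [ a ] q + [ m ] q)   ≡⟨ +-assoc (q ^ m * q ^ a) _ _ ⟨
    q ^ m * q ^ a + q ^ m * [ a ] q + [ m ] q     ≡⟨ cong (_+ [ m ] q) (*-distribˡ-+ (q ^ m) (q ^ a) ([ a ] q)) ⟨
    q ^ m * [ suc a ] q + [ m ] q                 ∎
    where open ≡-Reasoning

  [m]>0 : ∀ q .{{_ : NonZero q}} {m} → 1 ≤ m → 1 ≤ [ m ] q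
  [m]>0 q {suc m} _ = ≤-trans (m^n>0 q m) (m≤m+n (q ^ m) ([ m ] q))

  ^-cancelʳ-≤ : ∀ q {m n} → 1 < q → q ^ m ≤ q ^ n → m ≤ n
  ^-cancelʳ-≤ q {m} {n} 1<q q^m≤q^n with m ≤? n
  ... | yes m≤n = m≤n
  ... | no m≰n  = contradiction q^m≤q^n (<⇒≱ (^-monoʳ-< q 1<q (≰⇒> m≰n)))

  ^-injectiveʳ : ∀ q {m n} → 1 < q → q ^ m ≡ q ^ n → m ≡ n
  ^-injectiveʳ q 1<q eq = ≤-antisym (^-cancelʳ-≤ q 1<q (≤-reflexive eq)) (^-cancelʳ-≤ q 1<q (≤-reflexive (sym eq)))

  -- For a = Q c + K and N = Q a + K one has N (a + (s - 1) c) + (a - c)(s K) = s a² + (a - c) N,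
  -- so the two hypotheses together force (a - c)(s K) < (a - c) N.
  s*K<N : ∀ {Q c K a N s d} → 1 ≤ Q → 1 ≤ K → a ≡ Q * c + K → N ≡ Q * a + K →
          d * a ≡ a + (s ∸ 1) * c → s * a < d * N → s * K < N
  s*K<N {s = zero} _ 1≤K _ refl _ _ = ≤-trans 1≤K (m≤n+m _ _)
  s*K<N {suc Q′} {c} {K} {a} {N} {suc s′} {d} _ 1≤K refl refl d*a≡ s*a<d*N =
    *-cancelˡ-< e _ _ (+-cancelˡ-< (suc s′ * a * a) _ _ (begin-strict
      suc s′ * a * a + e * (suc s′ * K)   <⟨ +-monoˡ-< (e * (suc s′ * K)) s*a²<N*[a+s′c] ⟩
      N * (a + s′ * c) + e * (suc s′ * K) ≡⟨ identity Q′ c K s′ ⟩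
      suc s′ * a * a + e * N              ∎))
    where
    open ≤-Reasoning
    e = Q′ * c + K
    rearrange : ∀ d N a → d * N * a ≡ N * (d * a)
    rearrange = solve-∀
    s*a²<N*[a+s′c] : suc s′ * a * a < N * (a + s′ * c)
    s*a²<N*[a+s′c] = begin-strict
      suc s′ * a * a   <⟨ *-monoˡ-< a {{>-nonZero (≤-trans 1≤K (m≤n+m K _))}} s*a<d*N ⟩
      d * N * a        ≡⟨ rearrange d N a ⟩
      N * (d * a)      ≡⟨ cong (N *_) d*a≡ ⟩
      N * (a + s′ * c) ∎
    identity : ∀ Q′ c K s′ → let a = suc Q′ * c + K ; N = suc Q′ * a + K in
               N * (a + s′ * c) + (Q′ * c + K) * (suc s′ * K) ≡ suc s′ * a * a + (Q′ * c + K) * N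
    identity = solve-∀


module VectorSpace (F : FiniteField) where

  open import Data.Nat using (ℕ; zero; suc; _≤_; _<_; z≤n; s≤s; s≤s⁻¹; NonZero; >-nonZero)
    renaming (_+_ to _+ℕ_; _*_ to _*ℕ_; _^_ to _^ℕ_)
  import Data.Nat.Properties as ℕ
  open import Data.Fin using (Fin) renaming (zero to fzero; suc to fsuc)
  open import Data.Vec using ([]; _∷_; lookup; tabulate)
  open import Data.Vec.Properties using (∷-injective; lookup∘tabulate; ≡-dec)
  open import Data.Vec.Relation.Binary.Pointwise.Extensional using (ext; Pointwise-≡⇒≡)
  open import Data.List using (List; []; _∷_; _++_; length; map; concatMap; cartesianProduct)
  open import Data.List.Properties using (length-map; length-++; map-++; map-∘)
  import Data.List.Relation.Unary.Unique.Propositional.Properties as Unique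
  open import Data.List.Relation.Unary.Unique.Propositional using (Unique)
  open import Data.List.Relation.Unary.AllPairs using ([]; _∷_)
  open import Data.List.Relation.Unary.All using ([])
  open import Data.List.Membership.Propositional using (_∈_)
  open import Data.List.Membership.Propositional.Properties using (∈-map⁺; ∈-cartesianProduct⁺)
  open import Data.List.Relation.Unary.Any using (here)
  open import Data.Product using (Σ-syntax; ∃-syntax; _×_; _,_; proj₁; proj₂)
  open import Data.Sum using (inj₁; inj₂)
  open import Data.Unit using (⊤; tt)
  open import Relation.Nullary using (¬_; Dec; yes; no; contradiction)
  open import Relation.Nullary.Decidable using (¬?; _→-dec_; _×-dec_; decidable-stable)
  open import Data.Vec.Functional using () renaming (_∷_ to _∷ᶠ_)
  open import Function using (_∘_)
  open import Relation.Binary.PropositionalEquality hiding ([_])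
  open import Level using (0ℓ)
  open import Algebra.Bundles using (CommutativeRing; AbelianGroup)
  open import Algebra.Structures using (IsAbelianGroup)
  import Algebra.Properties.Ring as RingProperties
  import Algebra.Properties.AbelianGroup as AbelianGroupProperties
  import Algebra.Properties.CommutativeSemigroup as CommutativeSemigroupProperties

  open Counting
  open QNumbers

  open FiniteField F
  open Geometry F

  field-ring : CommutativeRing 0ℓ 0ℓ
  field-ring = record { isCommutativeRing = isCommutativeRing }

  open CommutativeRing field-ring
    using (+-assoc; +-comm; +-identityˡ; +-identityʳ; -‿inverseˡ;
           *-assoc; *-comm; *-identityˡ; *-identityʳ; zeroˡ; zeroʳ; distribˡ; distribʳ; ring)
  open RingProperties ring using (-1*x≈-x; x∙y⁻¹≈ε⇒x≈y)

  inv : (x : Carrier) → x ≢ 0# → Carrier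
  inv x x≢0 = proj₁ (inverse x x≢0)

  ⁻¹-inverseʳ : ∀ x (x≢0 : x ≢ 0#) → x * (inv x x≢0) ≡ 1#
  ⁻¹-inverseʳ x x≢0 = proj₂ (inverse x x≢0)

  ⁻¹-inverseˡ : ∀ x (x≢0 : x ≢ 0#) → (inv x x≢0) * x ≡ 1#
  ⁻¹-inverseˡ x x≢0 = trans (*-comm _ x) (⁻¹-inverseʳ x x≢0)

  neg : ∀ {n} → V n → V n
  neg v = (- 1#) · v

  _⊖_ : ∀ {n} → V n → V n → V n
  u ⊖ v = u ⊕ neg v

  ⊕-assoc : ∀ {n} (u v w : V n) → (u ⊕ v) ⊕ w ≡ u ⊕ (v ⊕ w)
  ⊕-assoc [] [] [] = refl
  ⊕-assoc (x ∷ u) (y ∷ v) (z ∷ w) = cong₂ _∷_ (+-assoc x y z) (⊕-assoc u v w)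

  ⊕-comm : ∀ {n} (u v : V n) → u ⊕ v ≡ v ⊕ u
  ⊕-comm [] [] = refl
  ⊕-comm (x ∷ u) (y ∷ v) = cong₂ _∷_ (+-comm x y) (⊕-comm u v)

  ⊕-identityˡ : ∀ {n} (v : V n) → 0v ⊕ v ≡ v
  ⊕-identityˡ [] = refl
  ⊕-identityˡ (x ∷ v) = cong₂ _∷_ (+-identityˡ x) (⊕-identityˡ v)

  ⊕-identityʳ : ∀ {n} (v : V n) → v ⊕ 0v ≡ v
  ⊕-identityʳ v = trans (⊕-comm v 0v) (⊕-identityˡ v)

  ⊕-inverseˡ : ∀ {n} (v : V n) → neg v ⊕ v ≡ 0v
  ⊕-inverseˡ [] = refl
  ⊕-inverseˡ (x ∷ v) = cong₂ _∷_ (trans (cong (_+ x) (-1*x≈-x x)) (-‿inverseˡ x)) (⊕-inverseˡ v)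

  ⊕-inverseʳ : ∀ {n} (v : V n) → v ⊕ neg v ≡ 0v
  ⊕-inverseʳ v = trans (⊕-comm v (neg v)) (⊕-inverseˡ v)

  ⊕-isAbelianGroup : ∀ n → IsAbelianGroup _≡_ (_⊕_ {n}) 0v neg
  ⊕-isAbelianGroup n = record
    { isGroup = record
      { isMonoid = record
        { isSemigroup = record
          { isMagma = record { isEquivalence = isEquivalence ; ∙-cong = cong₂ _⊕_ }
          ; assoc   = ⊕-assoc }
        ; identity = ⊕-identityˡ , ⊕-identityʳ }
      ; inverse = ⊕-inverseˡ , ⊕-inverseʳ
      ; ⁻¹-cong = cong neg }
    ; comm = ⊕-comm }

  ⊕-abelianGroup : ℕ → AbelianGroup 0ℓ 0ℓ
  ⊕-abelianGroup n = record { isAbelianGroup = ⊕-isAbelianGroup n }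

  module ⊕-Properties {n : ℕ} where
    open AbelianGroupProperties (⊕-abelianGroup n) public
    open CommutativeSemigroupProperties (AbelianGroup.commutativeSemigroup (⊕-abelianGroup n)) public
  open ⊕-Properties public using ()
    renaming ( ∙-cancelˡ to ⊕-cancelˡ ; ∙-cancelʳ to ⊕-cancelʳ ; x∙y⁻¹≈ε⇒x≈y to x⊖y≡0⇒x≡y
             ; inverseˡ-unique to ⊕-inverseˡ-unique ; \\-leftDividesʳ to neg-⊕-cancelˡ ; \\-leftDividesˡ to ⊕-neg-cancelˡ
             ; interchange to ⊕-interchange )

  ·-assoc : ∀ {n} a b (v : V n) → (a * b) · v ≡ a · (b · v)
  ·-assoc a b [] = refl
  ·-assoc a b (x ∷ v) = cong₂ _∷_ (*-assoc a b x) (·-assoc a b v)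

  ·-identityˡ : ∀ {n} (v : V n) → 1# · v ≡ v
  ·-identityˡ [] = refl
  ·-identityˡ (x ∷ v) = cong₂ _∷_ (*-identityˡ x) (·-identityˡ v)

  ·-zeroˡ : ∀ {n} (v : V n) → 0# · v ≡ 0v
  ·-zeroˡ [] = refl
  ·-zeroˡ (x ∷ v) = cong₂ _∷_ (zeroˡ x) (·-zeroˡ v)

  ·-zeroʳ : ∀ {n} a → a · 0v {n} ≡ 0v
  ·-zeroʳ {zero} a = refl
  ·-zeroʳ {suc n} a = cong₂ _∷_ (zeroʳ a) (·-zeroʳ a)

  ·-distribˡ-⊕ : ∀ {n} a (u v : V n) → a · (u ⊕ v) ≡ (a · u) ⊕ (a · v)
  ·-distribˡ-⊕ a [] [] = refl
  ·-distribˡ-⊕ a (x ∷ u) (y ∷ v) = cong₂ _∷_ (distribˡ a x y) (·-distribˡ-⊕ a u v)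

  ·-distribʳ-+ : ∀ {n} a b (v : V n) → (a + b) · v ≡ (a · v) ⊕ (b · v)
  ·-distribʳ-+ a b [] = refl
  ·-distribʳ-+ a b (x ∷ v) = cong₂ _∷_ (distribʳ x a b) (·-distribʳ-+ a b v)

  ·-inverseˡ : ∀ {n} a (a≢0 : a ≢ 0#) (v : V n) → (inv a a≢0) · (a · v) ≡ v
  ·-inverseˡ a a≢0 v = trans (sym (·-assoc _ a v)) (trans (cong (_· v) (⁻¹-inverseˡ a a≢0)) (·-identityˡ v))

  ·-inverseʳ : ∀ {n} a (a≢0 : a ≢ 0#) (v : V n) → a · ((inv a a≢0) · v) ≡ v
  ·-inverseʳ a a≢0 v = trans (sym (·-assoc a _ v)) (trans (cong (_· v) (⁻¹-inverseʳ a a≢0)) (·-identityˡ v))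

  _≟ᵛ_ : ∀ {n} (u v : V n) → Dec (u ≡ v)
  _≟ᵛ_ = ≡-dec _≟_

  lookup-ext : ∀ {m} {c c′ : V m} → (∀ i → lookup c i ≡ lookup c′ i) → c ≡ c′
  lookup-ext c≗c′ = Pointwise-≡⇒≡ (ext c≗c′)

  q : ℕ
  q = order

  scalars : Enumeration Carrier
  scalars = record { list = elements ; unique = elements-unique ; complete = elements-complete }

  private
    cons : ∀ {n} → Carrier × V n → V (suc n)
    cons (x , v) = x ∷ v

    concatMap≡map-cartesianProduct : ∀ {n} (xs : List Carrier) (vs : List (V n)) →
      concatMap (λ x → map (x ∷_) vs) xs ≡ map cons (cartesianProduct xs vs)
    concatMap≡map-cartesianProduct [] vs = refl
    concatMap≡map-cartesianProduct (x ∷ xs) vs = begin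
      map (x ∷_) vs ++ concatMap (λ x → map (x ∷_) vs) xs
        ≡⟨ cong₂ _++_ (map-∘ vs) (concatMap≡map-cartesianProduct xs vs) ⟩
      map cons (map (x ,_) vs) ++ map cons (cartesianProduct xs vs)
        ≡⟨ map-++ cons (map (x ,_) vs) (cartesianProduct xs vs) ⟨
      map cons (map (x ,_) vs ++ cartesianProduct xs vs) ∎
      where open ≡-Reasoning

    cons-injective : ∀ {n} {u v : Carrier × V n} → cons u ≡ cons v → u ≡ v
    cons-injective {u = x , u} {y , v} eq = let (x≡y , u≡v) = ∷-injective eq in cong₂ _,_ x≡y u≡v

    allVecs-unique : ∀ n → Unique (allVecs n)
    allVecs-unique zero    = [] ∷ []
    allVecs-unique (suc n) = subst Unique (sym (concatMap≡map-cartesianProduct elements (allVecs n)))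
      (Unique.map⁺ cons-injective (Unique.cartesianProduct⁺ elements-unique (allVecs-unique n)))

    allVecs-complete : ∀ {n} (v : V n) → v ∈ allVecs n
    allVecs-complete []       = here refl
    allVecs-complete {suc n} (x ∷ v) = subst (_ ∈_) (sym (concatMap≡map-cartesianProduct elements (allVecs n)))
      (∈-map⁺ cons (∈-cartesianProduct⁺ (elements-complete x) (allVecs-complete v)))

  vectors : ∀ n → Enumeration (V n)
  vectors n = record { list = allVecs n ; unique = allVecs-unique n ; complete = allVecs-complete }

  length-allVecs : ∀ n → length (allVecs n) ≡ q ^ℕ n
  length-allVecs zero    = refl
  length-allVecs (suc n) = rows elements
    where
    rows : ∀ xs → length (concatMap (λ x → map (x ∷_) (allVecs n)) xs) ≡ length xs *ℕ q ^ℕ n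
    rows []       = refl
    rows (x ∷ xs) = trans (length-++ (map (x ∷_) (allVecs n)))
                          (cong₂ _+ℕ_ (trans (length-map (x ∷_) (allVecs n)) (length-allVecs n)) (rows xs))

  lincomb-∈ : ∀ {n m} (W : Subspace n) (c : Fin m → Carrier) {b : Fin m → V n} →
              (∀ i → mem W (b i)) → mem W (lincomb c b)
  lincomb-∈ {m = zero}  W c b∈W = 0∈ W
  lincomb-∈ {m = suc m} W c b∈W = ⊕∈ W (·∈ W (c fzero) (b∈W fzero)) (lincomb-∈ W (c ∘ fsuc) (b∈W ∘ fsuc))

  lincomb-cong : ∀ {n m} {c c′ : Fin m → Carrier} (b : Fin m → V n) → (∀ i → c i ≡ c′ i) →
                 lincomb c b ≡ lincomb c′ b
  lincomb-cong {m = zero}  b c≗c′ = refl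
  lincomb-cong {m = suc m} b c≗c′ = cong₂ _⊕_ (cong (_· b fzero) (c≗c′ fzero)) (lincomb-cong (b ∘ fsuc) (c≗c′ ∘ fsuc))

  lincomb-zero : ∀ {n m} (b : Fin m → V n) → lincomb (λ _ → 0#) b ≡ 0v
  lincomb-zero {m = zero}  b = refl
  lincomb-zero {m = suc m} b = trans (cong₂ _⊕_ (·-zeroˡ (b fzero)) (lincomb-zero (b ∘ fsuc))) (⊕-identityˡ 0v)

  lincomb-⊕ : ∀ {n m} (c c′ : Fin m → Carrier) (b : Fin m → V n) →
              lincomb c b ⊕ lincomb c′ b ≡ lincomb (λ i → c i + c′ i) b
  lincomb-⊕ {m = zero}  c c′ b = ⊕-identityˡ 0v
  lincomb-⊕ {m = suc m} c c′ b = trans (⊕-interchange _ _ _ _)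
    (cong₂ _⊕_ (sym (·-distribʳ-+ (c fzero) (c′ fzero) (b fzero))) (lincomb-⊕ (c ∘ fsuc) (c′ ∘ fsuc) (b ∘ fsuc)))

  lincomb-· : ∀ {n m} a (c : Fin m → Carrier) (b : Fin m → V n) → a · lincomb c b ≡ lincomb (λ i → a * c i) b
  lincomb-· {m = zero}  a c b = ·-zeroʳ a
  lincomb-· {m = suc m} a c b = trans (·-distribˡ-⊕ a _ _)
    (cong₂ _⊕_ (sym (·-assoc a (c fzero) (b fzero))) (lincomb-· a (c ∘ fsuc) (b ∘ fsuc)))

  lincomb-⊖ : ∀ {n m} (c c′ : Fin m → Carrier) (b : Fin m → V n) →
              lincomb c b ⊖ lincomb c′ b ≡ lincomb (λ i → c i + ((- 1#) * c′ i)) b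
  lincomb-⊖ c c′ b = trans (cong (lincomb c b ⊕_) (lincomb-· (- 1#) c′ b)) (lincomb-⊕ c _ b)

  lincomb-injective : ∀ {n m} {b : Fin m → V n} → LinIndep b → ∀ {c c′} → lincomb c b ≡ lincomb c′ b → ∀ i → c i ≡ c′ i
  lincomb-injective {b = b} independent {c} {c′} eq i = x∙y⁻¹≈ε⇒x≈y (c i) (c′ i)
    (trans (cong (c i +_) (sym (-1*x≈-x (c′ i))))
           (independent _ (trans (sym (lincomb-⊖ c c′ b)) (trans (cong (_⊖ lincomb c′ b) eq) (⊕-inverseʳ _))) i))

  _⊆_ : ∀ {n} → Subspace n → Subspace n → Set
  M ⊆ W = ∀ {v} → mem M v → mem W v

  _⊆?_ : ∀ {n} (M W : Subspace n) → Dec (M ⊆ W)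
  _⊆?_ {n} M W with ∀? (vectors n) (λ v → dec M v →-dec dec W v)
  ... | yes M⊆W = yes (M⊆W _)
  ... | no M⊈W  = no λ M⊆W → M⊈W λ _ → M⊆W

  ⊖∈ : ∀ {n} (W : Subspace n) {u v} → mem W u → mem W v → mem W (u ⊖ v)
  ⊖∈ W u∈W v∈W = ⊕∈ W u∈W (·∈ W (- 1#) v∈W)

  ⊤ˢ : ∀ {n} → Subspace n
  ⊤ˢ = record { mem = λ _ → ⊤ ; dec = λ _ → yes tt ; 0∈ = tt ; ⊕∈ = λ _ _ → tt ; ·∈ = λ _ _ → tt }

  ∣_∣ : ∀ {n} → Subspace n → ℕ
  ∣_∣ {n} W = count (dec W) (allVecs n)

  ∣⊤ˢ∣≡q^n : ∀ n → ∣ ⊤ˢ {n} ∣ ≡ q ^ℕ n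
  ∣⊤ˢ∣≡q^n n = trans (count-all (λ _ → yes tt) (allVecs n) (λ _ → tt)) (length-allVecs n)

  ∣F×W∣≡q*∣W∣ : ∀ {n} (W : Subspace n) → count ((λ _ → yes tt) ⊗? dec W) (list (scalars ×ᴱ vectors n)) ≡ q *ℕ ∣ W ∣
  ∣F×W∣≡q*∣W∣ {n} W = trans (count-cartesianProduct (λ _ → yes tt) (dec W) elements (allVecs n))
                            (cong (_*ℕ ∣ W ∣) (count-all (λ _ → yes tt) elements (λ _ → tt)))

  ∣W∣≡q^dim : ∀ {n m} (W : Subspace n) → HasDim W m → ∣ W ∣ ≡ q ^ℕ m
  ∣W∣≡q^dim {n} {m} W (b , b∈W , independent , spanning) = begin
    ∣ W ∣                                  ≡⟨ bijection⇒count≡ (λ _ → yes tt) (dec W) (vectors m) (vectors n) coords→vector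
                                                (λ _ → lincomb-∈ W _ b∈W)
                                                (λ _ _ eq → lookup-ext (lincomb-injective independent eq))
                                                (λ v∈W → let (c , v≡) = spanning _ v∈W in
                                                   tabulate c , tt , trans (lincomb-cong b (lookup∘tabulate c)) (sym v≡)) ⟨
    ∣ ⊤ˢ {m} ∣                             ≡⟨ ∣⊤ˢ∣≡q^n m ⟩
    q ^ℕ m                                 ∎
    where
    open ≡-Reasoning
    coords→vector : V m → V n
    coords→vector c = lincomb (lookup c) b

  q-1 : ℕ
  q-1 = count (λ x → ¬? (x ≟ 0#)) elements

  q≡1+q-1 : q ≡ suc q-1
  q≡1+q-1 = begin
    q
      ≡⟨ count-all (λ _ → yes tt) elements (λ _ → tt) ⟨
    count (λ _ → yes tt) elements
      ≡⟨ count≡1+count≢ (λ _ → yes tt) _≟_ elements-unique (elements-complete 0#) tt ⟩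
    suc (count (λ x → yes tt ×-dec ¬? (x ≟ 0#)) elements)
      ≡⟨ cong suc (count-cong _ _ elements (λ _ → proj₂) (λ _ x≢0 → tt , x≢0)) ⟩
    suc q-1
      ∎
    where open ≡-Reasoning

  1≤q-1 : 1 ≤ q-1
  1≤q-1 = 1≤count (λ x → ¬? (x ≟ 0#)) (elements-complete 1#) (0≢1 ∘ sym)

  1<q : 1 < q
  1<q = subst (1 <_) (sym q≡1+q-1) (s≤s 1≤q-1)

  instance
    q-nonZero : NonZero q
    q-nonZero = >-nonZero (ℕ.<-trans (s≤s z≤n) 1<q)

    q-1-nonZero : NonZero q-1
    q-1-nonZero = >-nonZero 1≤q-1

  ·-cancelˡ : ∀ {n} {c} {u v : V n} → c ≢ 0# → c · u ≡ c · v → u ≡ v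
  ·-cancelˡ {c = c} {u} {v} c≢0 eq = trans (sym (·-inverseˡ c c≢0 u)) (trans (cong (inv c c≢0 ·_) eq) (·-inverseˡ c c≢0 v))

  ·-≢0 : ∀ {n} {c} {u : V n} → c ≢ 0# → u ≢ 0v → c · u ≢ 0v
  ·-≢0 {c = c} {u} c≢0 u≢0 cu≡0 = u≢0 (·-cancelˡ c≢0 (trans cu≡0 (sym (·-zeroʳ c))))

  normalised⇒≢0 : ∀ {n} {u : V n} → Normalised u → u ≢ 0v
  normalised⇒≢0 {u = _ ∷ _} (inj₁ refl)      eq = 0≢1 (sym (proj₁ (∷-injective eq)))
  normalised⇒≢0 {u = _ ∷ _} (inj₂ (_ , nu)) eq = normalised⇒≢0 nu (proj₂ (∷-injective eq))

  normalise : ∀ {n} (v : V n) → v ≢ 0v → Σ[ c ∈ Carrier ] Σ[ u ∈ V n ] (c ≢ 0# × Normalised u × v ≡ c · u)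
  normalise [] v≢0 = contradiction refl v≢0
  normalise (x ∷ v) v≢0 with x ≟ 0#
  ... | no x≢0  = x , 1# ∷ (inv x x≢0 · v) , x≢0 , inj₁ refl , cong₂ _∷_ (sym (*-identityʳ x)) (sym (·-inverseʳ x x≢0 v))
  ... | yes refl with c , u , c≢0 , nu , v≡cu ← normalise v (v≢0 ∘ cong (0# ∷_)) =
    c , 0# ∷ u , c≢0 , inj₂ (refl , nu) , cong₂ _∷_ (sym (zeroʳ c)) v≡cu

  normalised-scalar-unique : ∀ {n} {c c′} {u u′ : V n} → c ≢ 0# → c′ ≢ 0# → Normalised u → Normalised u′ →
                             c · u ≡ c′ · u′ → c ≡ c′
  normalised-scalar-unique {u = _ ∷ _} {_ ∷ _} _ _ (inj₁ refl) (inj₁ refl) eq =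
    trans (sym (*-identityʳ _)) (trans (proj₁ (∷-injective eq)) (*-identityʳ _))
  normalised-scalar-unique {u = _ ∷ _} {_ ∷ _} c≢0 _ (inj₁ refl) (inj₂ (refl , _)) eq =
    contradiction (trans (sym (*-identityʳ _)) (trans (proj₁ (∷-injective eq)) (zeroʳ _))) c≢0
  normalised-scalar-unique {u = _ ∷ _} {_ ∷ _} _ c′≢0 (inj₂ (refl , _)) (inj₁ refl) eq =
    contradiction (trans (sym (*-identityʳ _)) (trans (sym (proj₁ (∷-injective eq))) (zeroʳ _))) c′≢0
  normalised-scalar-unique {u = _ ∷ _} {_ ∷ _} c≢0 c′≢0 (inj₂ (refl , nu)) (inj₂ (refl , nu′)) eq =
    normalised-scalar-unique c≢0 c′≢0 nu nu′ (proj₂ (∷-injective eq))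

  -- Every nonzero vector of W is uniquely c · u with c ≠ 0 and u a normalised point of W.
  ∣W∣≡1+q-1*#points : ∀ {n} (W : Subspace n) → ∣ W ∣ ≡ suc (q-1 *ℕ #points (dec W))
  ∣W∣≡1+q-1*#points {n} W = begin
    ∣ W ∣
      ≡⟨ count≡1+count≢ (dec W) _≟ᵛ_ (allVecs-unique n) (allVecs-complete 0v) (0∈ W) ⟩
    suc (count (λ v → dec W v ×-dec ¬? (v ≟ᵛ 0v)) (allVecs n))
      ≡⟨ cong suc (bijection⇒count≡ _ _ (scalars ×ᴱ vectors n) (vectors n) scale
           (λ (c≢0 , nu , u∈W) → ·∈ W _ u∈W , ·-≢0 c≢0 (normalised⇒≢0 nu)) scale-injective scale-onto) ⟨
    suc (count (nonzero? ⊗? point?) (cartesianProduct elements (allVecs n)))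
      ≡⟨ cong suc (count-cartesianProduct nonzero? point? elements (allVecs n)) ⟩
    suc (q-1 *ℕ #points (dec W))
      ∎
    where
    open ≡-Reasoning
    nonzero? = λ c → ¬? (c ≟ 0#)
    point? = λ v → normalised? v ×-dec dec W v
    scale : Carrier × V n → V n
    scale (c , u) = c · u
    scale-injective : InjectiveOn (λ (c , u) → c ≢ 0# × Normalised u × mem W u) scale
    scale-injective (c≢0 , nu , _) (c′≢0 , nu′ , _) eq =
      let c≡c′ = normalised-scalar-unique c≢0 c′≢0 nu nu′ eq in
      cong₂ _,_ c≡c′ (·-cancelˡ c≢0 (trans eq (cong (_· _) (sym c≡c′))))
    scale-onto : SurjectiveOnto (λ (c , u) → c ≢ 0# × Normalised u × mem W u) (λ v → mem W v × v ≢ 0v) scale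
    scale-onto {v} (v∈W , v≢0) = let (c , u , c≢0 , nu , v≡cu) = normalise v v≢0 in
      (c , u) , (c≢0 , nu , subst (mem W) (trans (cong (inv c c≢0 ·_) v≡cu) (·-inverseˡ c c≢0 u)) (·∈ W (inv c c≢0) v∈W)) ,
      sym v≡cu

  q^m≡1+q-1*[m] : ∀ m → q ^ℕ m ≡ suc (q-1 *ℕ [ m ] q)
  q^m≡1+q-1*[m] m = begin
    q ^ℕ m                        ≡⟨ cong (_^ℕ m) q≡1+q-1 ⟩
    suc q-1 ^ℕ m                  ≡⟨ [m]-geometric q-1 m ⟨
    suc (q-1 *ℕ [ m ] suc q-1)    ≡⟨ cong (λ q → suc (q-1 *ℕ [ m ] q)) q≡1+q-1 ⟨
    suc (q-1 *ℕ [ m ] q)          ∎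
    where open ≡-Reasoning

  ∣W∣≡q^m⇒#points≡[m] : ∀ {n m} (W : Subspace n) → ∣ W ∣ ≡ q ^ℕ m → #points (dec W) ≡ [ m ] q
  ∣W∣≡q^m⇒#points≡[m] {m = m} W ∣W∣≡q^m = ℕ.*-cancelˡ-≡ _ _ q-1
    (ℕ.suc-injective (trans (sym (∣W∣≡1+q-1*#points W)) (trans ∣W∣≡q^m (q^m≡1+q-1*[m] m))))

  ∣W∣≤q^m⇒#points≤[m] : ∀ {n m} (W : Subspace n) → ∣ W ∣ ≤ q ^ℕ m → #points (dec W) ≤ [ m ] q
  ∣W∣≤q^m⇒#points≤[m] {m = m} W ∣W∣≤q^m = ℕ.*-cancelˡ-≤ q-1
    (s≤s⁻¹ (subst₂ _≤_ (∣W∣≡1+q-1*#points W) (q^m≡1+q-1*[m] m) ∣W∣≤q^m))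

  #points-⊤ˢ : ∀ n → #points (dec (⊤ˢ {n})) ≡ [ n ] q
  #points-⊤ˢ n = ∣W∣≡q^m⇒#points≡[m] {n} {n} ⊤ˢ (∣⊤ˢ∣≡q^n n)

  #points-dim : ∀ {n m} (W : Subspace n) → HasDim W m → #points (dec W) ≡ [ m ] q
  #points-dim {m = m} W dim-W = ∣W∣≡q^m⇒#points≡[m] {m = m} W (∣W∣≡q^dim W dim-W)

  #points-cong : ∀ {n} {P Q : V n → Set} (P? : ∀ v → Dec (P v)) (Q? : ∀ v → Dec (Q v)) →
                 (∀ {v} → Normalised v → P v → Q v) → (∀ {v} → Normalised v → Q v → P v) → #points P? ≡ #points Q?
  #points-cong {n} P? Q? P⇒Q Q⇒P =
    count-cong _ _ (allVecs n) (λ _ (nv , pv) → nv , P⇒Q nv pv) (λ _ (nv , qv) → nv , Q⇒P nv qv)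

  InSpan : ∀ {n m} → (Fin m → V n) → V n → Set
  InSpan {m = m} b v = Σ[ c ∈ V m ] v ≡ lincomb (lookup c) b

  span? : ∀ {n m} (b : Fin m → V n) v → Dec (InSpan b v)
  span? {m = m} b v = ∃? (vectors m) (λ c → v ≟ᵛ lincomb (lookup c) b)

  independent-∷ : ∀ {n m} {b : Fin m → V n} {v} → LinIndep b → ¬ InSpan b v → LinIndep (v ∷ᶠ b)
  independent-∷ {b = b} {v} independent v∉span c eq with c fzero ≟ 0#
  ... | yes c₀≡0 = λ { fzero → c₀≡0 ; (fsuc i) → independent (c ∘ fsuc) tail≡0 i }
    where
    open ≡-Reasoning
    tail≡0 : lincomb (c ∘ fsuc) b ≡ 0v
    tail≡0 = begin
      lincomb (c ∘ fsuc) b                   ≡⟨ ⊕-identityˡ _ ⟨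
      0v ⊕ lincomb (c ∘ fsuc) b              ≡⟨ cong (_⊕ lincomb (c ∘ fsuc) b) (trans (cong (_· v) c₀≡0) (·-zeroˡ v)) ⟨
      (c fzero · v) ⊕ lincomb (c ∘ fsuc) b   ≡⟨ eq ⟩
      0v                                     ∎
  ... | no c₀≢0 = contradiction (tabulate (λ j → inv c₀ c₀≢0 * ((- 1#) * c (fsuc j))) , v∈span) v∉span
    where
    open ≡-Reasoning
    c₀ = c fzero
    v∈span : v ≡ lincomb (lookup (tabulate (λ j → inv c₀ c₀≢0 * ((- 1#) * c (fsuc j))))) b
    v∈span = begin
      v                                                    ≡⟨ ·-inverseˡ c₀ c₀≢0 v ⟨
      inv c₀ c₀≢0 · (c₀ · v)                                ≡⟨ cong (inv c₀ c₀≢0 ·_) (⊕-inverseˡ-unique _ _ eq) ⟩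
      inv c₀ c₀≢0 · neg (lincomb (c ∘ fsuc) b)              ≡⟨ cong (inv c₀ c₀≢0 ·_) (lincomb-· (- 1#) (c ∘ fsuc) b) ⟩
      inv c₀ c₀≢0 · lincomb (λ j → (- 1#) * c (fsuc j)) b   ≡⟨ lincomb-· (inv c₀ c₀≢0) _ b ⟩
      lincomb (λ j → inv c₀ c₀≢0 * ((- 1#) * c (fsuc j))) b ≡⟨ lincomb-cong b (lookup∘tabulate _) ⟨
      _                                                    ∎

  injective⇒≤ : ∀ {m n} (f : V m → V n) → (∀ {u v} → f u ≡ f v → u ≡ v) → m ≤ n
  injective⇒≤ {m} {n} f f-injective = ^-cancelʳ-≤ q 1<q (begin
    q ^ℕ m        ≡⟨ ∣⊤ˢ∣≡q^n m ⟨
    ∣ ⊤ˢ {m} ∣    ≤⟨ injection⇒count≤ (dec ⊤ˢ) (dec ⊤ˢ) (vectors n) (allVecs-unique m) f (λ _ → tt) (λ _ _ → f-injective) ⟩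
    ∣ ⊤ˢ {n} ∣    ≡⟨ ∣⊤ˢ∣≡q^n n ⟩
    q ^ℕ n        ∎)
    where open ℕ.≤-Reasoning

  independent⇒≤ : ∀ {n m} {b : Fin m → V n} → LinIndep b → m ≤ n
  independent⇒≤ {b = b} independent = injective⇒≤ (λ c → lincomb (lookup c) b) (lookup-ext ∘ lincomb-injective independent)

  independent⇒spanning : ∀ {n} {b : Fin n → V n} → LinIndep b → ∀ v → InSpan b v
  independent⇒spanning {n} {b} independent v = count≥length⇒all (span? b) (allVecs n) (begin
    length (allVecs n)                  ≡⟨ count-all (λ _ → yes tt) (allVecs n) (λ _ → tt) ⟨
    ∣ ⊤ˢ {n} ∣                          ≤⟨ injection⇒count≤ (λ _ → yes tt) (span? b) (vectors n) (allVecs-unique n)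
                                             (λ c → lincomb (lookup c) b) (λ {c} _ → c , refl)
                                             (λ _ _ eq → lookup-ext (lincomb-injective independent eq)) ⟩
    count (span? b) (allVecs n)         ∎) (allVecs-complete v)
    where open ℕ.≤-Reasoning

  basis-exists : ∀ {n} (W : Subspace n) → ∃[ m ] HasDim W m
  basis-exists {n} W = extend (suc n) (λ ()) (λ _ _ ()) (λ ()) (subst (n <_) (sym (ℕ.+-identityʳ (suc n))) (ℕ.n<1+n n))
    where
    extend : ∀ fuel {r} (b : Fin r → V n) → LinIndep b → (∀ i → mem W (b i)) → n < fuel +ℕ r → ∃[ m ] HasDim W m
    extend zero b independent _ n<r = contradiction (independent⇒≤ independent) (ℕ.<⇒≱ n<r)
    extend (suc fuel) {r} b independent b∈W n<1+fuel+r with ∃? (vectors n) (λ v → dec W v ×-dec ¬? (span? b v))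
    ... | yes (v , v∈W , v∉span) = extend fuel (v ∷ᶠ b) (independent-∷ independent v∉span)
                                    (λ { fzero → v∈W ; (fsuc i) → b∈W i }) (subst (n <_) (sym (ℕ.+-suc fuel r)) n<1+fuel+r)
    ... | no ∄ = r , b , b∈W , independent , λ v v∈W →
      let (c , v≡) = decidable-stable (span? b v) (λ v∉span → ∄ (v , v∈W , v∉span)) in lookup c , v≡

  ¬⊆⇒∃ : ∀ {n} {M W : Subspace n} → ¬ M ⊆ W → ∃[ w ] mem M w × ¬ mem W w
  ¬⊆⇒∃ {n} {M} {W} M⊈W with ∃? (vectors n) (λ w → dec M w ×-dec ¬? (dec W w))
  ... | yes found = found
  ... | no ∄      = contradiction (λ {w} w∈M → decidable-stable (dec W w) λ w∉W → ∄ (w , w∈M , w∉W)) M⊈W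

  q*∣M∩H∣≡∣M∣ : ∀ {n} {H : Subspace n} → IsHyperplane H → (M : Subspace n) → ∀ {w} → mem M w → ¬ mem H w →
                q *ℕ ∣ M ∩ H ∣ ≡ ∣ M ∣
  q*∣M∩H∣≡∣M∣ {zero} {H} _ M {[]} _ w∉H = contradiction (0∈ H) w∉H
  q*∣M∩H∣≡∣M∣ {suc n} {H} (hb , hb∈H , hb-independent , hb-spanning) M {w} w∈M w∉H = begin
    q *ℕ ∣ M ∩ H ∣
      ≡⟨ ∣F×W∣≡q*∣W∣ (M ∩ H) ⟨
    count ((λ _ → yes tt) ⊗? dec (M ∩ H)) (list (scalars ×ᴱ vectors (suc n)))
      ≡⟨ bijection⇒count≡ _ (dec M) (scalars ×ᴱ vectors (suc n)) (vectors (suc n)) f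
                                                               (λ (_ , h∈M , _) → ⊕∈ M (·∈ M _ w∈M) h∈M) f-injective f-onto ⟩
    ∣ M ∣                                                 ∎
    where
    open ≡-Reasoning
    B = w ∷ᶠ hb
    B-independent : LinIndep B
    B-independent = independent-∷ {b = hb} {v = w} hb-independent λ (c , w≡) →
      w∉H (subst (mem H) (sym w≡) (lincomb-∈ H _ hb∈H))
    f : Carrier × V (suc n) → V (suc n)
    f (c , h) = (c · w) ⊕ h
    f-injective : InjectiveOn (λ (_ , h) → ⊤ × mem (M ∩ H) h) f
    f-injective {c , h} {c′ , h′} (_ , _ , h∈H) (_ , _ , h′∈H) eq =
      let (a , h≡) = hb-spanning h h∈H ; (a′ , h′≡) = hb-spanning h′ h′∈H
          coeffs≡ = lincomb-injective {b = B} B-independent {c ∷ᶠ a} {c′ ∷ᶠ a′}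
                      (trans (cong (_ ⊕_) (sym h≡)) (trans eq (cong (_ ⊕_) h′≡)))
      in cong₂ _,_ (coeffs≡ fzero) (trans h≡ (trans (lincomb-cong hb (coeffs≡ ∘ fsuc)) (sym h′≡)))
    f-onto : SurjectiveOnto (λ (_ , h) → ⊤ × mem (M ∩ H) h) (mem M) f
    f-onto {v} v∈M =
      let (c , v≡) = independent⇒spanning {b = B} B-independent v
          x = lookup c fzero · w
          h = lincomb (lookup c ∘ fsuc) hb
          h≡ : neg x ⊕ v ≡ h
          h≡ = trans (cong (neg x ⊕_) v≡) (neg-⊕-cancelˡ x h)
      in (lookup c fzero , h) , (tt , subst (mem M) h≡ (⊕∈ M (·∈ M (- 1#) (·∈ M _ w∈M)) v∈M) , lincomb-∈ H _ hb∈H) , sym v≡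

  #points-∩-hyperplane : ∀ {n j} {M H : Subspace n} → HasDim M (suc j) → IsHyperplane H → ¬ M ⊆ H →
                         #points (dec (M ∩ H)) ≡ [ j ] q
  #points-∩-hyperplane {j = j} {M} {H} dim-M isHyperplane M⊈H =
    let (w , w∈M , w∉H) = ¬⊆⇒∃ {M = M} {H} M⊈H in
    ∣W∣≡q^m⇒#points≡[m] {m = j} (M ∩ H) (ℕ.*-cancelˡ-≡ _ _ q
      (trans (q*∣M∩H∣≡∣M∣ {H = H} isHyperplane M w∈M w∉H) (∣W∣≡q^dim M dim-M)))

  ⊕≡⊕⇒⊖≡⊖ : ∀ {n} {x y x₀ y₀ : V n} → x ⊕ y ≡ x₀ ⊕ y₀ → x ⊖ x₀ ≡ y₀ ⊖ y
  ⊕≡⊕⇒⊖≡⊖ {x = x} {y} {x₀} {y₀} eq = ⊕-cancelʳ (x₀ ⊕ y) _ _ (begin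
    (x ⊖ x₀) ⊕ (x₀ ⊕ y)          ≡⟨ cong ((x ⊖ x₀) ⊕_) (⊕-comm x₀ y) ⟩
    (x ⊕ neg x₀) ⊕ (y ⊕ x₀)      ≡⟨ ⊕-interchange x (neg x₀) y x₀ ⟩
    (x ⊕ y) ⊕ (neg x₀ ⊕ x₀)      ≡⟨ cong₂ _⊕_ eq (⊕-inverseˡ x₀) ⟩
    (x₀ ⊕ y₀) ⊕ 0v               ≡⟨ cong₂ _⊕_ (⊕-comm y₀ x₀) (⊕-inverseˡ y) ⟨
    (y₀ ⊕ x₀) ⊕ (neg y ⊕ y)      ≡⟨ ⊕-interchange y₀ x₀ (neg y) y ⟩
    (y₀ ⊖ y) ⊕ (x₀ ⊕ y)          ∎)
    where open ≡-Reasoning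

  -- The pairs (x , y) ∈ M × M′ with x ⊕ y = w form a coset of M ∩ M′ inside M × M′ (or are empty),
  -- and they are empty unless w ∈ W.
  ∣M∣*∣M′∣≤∣M∩M′∣*∣W∣ : ∀ {n} {M M′ W : Subspace n} → M ⊆ W → M′ ⊆ W → ∣ M ∣ *ℕ ∣ M′ ∣ ≤ ∣ M ∩ M′ ∣ *ℕ ∣ W ∣
  ∣M∣*∣M′∣≤∣M∩M′∣*∣W∣ {n} {M} {M′} {W} M⊆W M′⊆W = begin
    ∣ M ∣ *ℕ ∣ M′ ∣
      ≡⟨ count-cartesianProduct (dec M) (dec M′) (allVecs n) (allVecs n) ⟨
    count (dec M ⊗? dec M′) (list pairs)
      ≡⟨ count-fibres (dec M ⊗? dec M′) sum _≟ᵛ_ (vectors n) (list pairs) ⟩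
    ∑[ w ∈ allVecs n ] fibre w
      ≤⟨ ∑-mono (allVecs n) (λ {w} _ → fibre≤ w) ⟩
    ∑[ w ∈ allVecs n ] (∣ M ∩ M′ ∣ *ℕ indicator (dec W w))
      ≡⟨ ∑-*ˡ ∣ M ∩ M′ ∣ (indicator ∘ dec W) (allVecs n) ⟩
    ∣ M ∩ M′ ∣ *ℕ ∑[ w ∈ allVecs n ] indicator (dec W w)
      ≡⟨ cong (∣ M ∩ M′ ∣ *ℕ_) (∑-indicator (dec W) (allVecs n)) ⟩
    ∣ M ∩ M′ ∣ *ℕ ∣ W ∣
      ∎
    where
    open ℕ.≤-Reasoning
    pairs = vectors n ×ᴱ vectors n
    sum : V n × V n → V n
    sum (x , y) = x ⊕ y
    fibre : V n → ℕ
    fibre w = count (λ p → (dec M ⊗? dec M′) p ×-dec (sum p ≟ᵛ w)) (list pairs)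
    fibre≤ : ∀ w → fibre w ≤ ∣ M ∩ M′ ∣ *ℕ indicator (dec W w)
    fibre≤ w with dec W w
    ... | no w∉W = ℕ.≤-reflexive (trans (count-none _ (list pairs) λ _ ((x∈M , y∈M′) , x⊕y≡w) →
                     w∉W (subst (mem W) x⊕y≡w (⊕∈ W (M⊆W x∈M) (M′⊆W y∈M′)))) (sym (ℕ.*-zeroʳ ∣ M ∩ M′ ∣)))
    ... | yes _ with ∃? pairs (λ p → (dec M ⊗? dec M′) p ×-dec (sum p ≟ᵛ w))
    ...   | no ∄ = ℕ.≤-trans (ℕ.≤-reflexive (count-none _ (list pairs) λ {p} _ p∈ → ∄ (p , p∈))) z≤n
    ...   | yes ((x₀ , y₀) , (x₀∈M , y₀∈M′) , x₀⊕y₀≡w) = subst (fibre w ≤_) (sym (ℕ.*-identityʳ _))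
      (injection⇒count≤ _ (dec (M ∩ M′)) (vectors n) (unique pairs) (λ (x , y) → x ⊖ x₀)
        (λ {(x , y)} ((x∈M , y∈M′) , x⊕y≡w) → ⊖∈ M x∈M x₀∈M ,
           subst (mem M′) (sym (⊕≡⊕⇒⊖≡⊖ (trans x⊕y≡w (sym x₀⊕y₀≡w)))) (⊖∈ M′ y₀∈M′ y∈M′))
        λ {(x , y)} {(x′ , y′)} (_ , x⊕y≡w) (_ , x′⊕y′≡w) x⊖x₀≡x′⊖x₀ →
          let x≡x′ = ⊕-cancelʳ (neg x₀) x x′ x⊖x₀≡x′⊖x₀ in
          cong₂ _,_ x≡x′ (⊕-cancelˡ x y y′ (trans x⊕y≡w (trans (sym x′⊕y′≡w) (cong (_⊕ y′) (sym x≡x′))))))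

  dim-∩-bound : ∀ {n a b c w} {M M′ W : Subspace n} → HasDim M a → HasDim M′ b → HasDim (M ∩ M′) c → HasDim W w →
                M ⊆ W → M′ ⊆ W → a +ℕ b ≤ c +ℕ w
  dim-∩-bound {a = a} {b} {c} {w} {M} {M′} {W} dim-M dim-M′ dim-M∩M′ dim-W M⊆W M′⊆W = ^-cancelʳ-≤ q 1<q (begin
    q ^ℕ (a +ℕ b)              ≡⟨ ℕ.^-distribˡ-+-* q a b ⟩
    q ^ℕ a *ℕ q ^ℕ b           ≡⟨ cong₂ _*ℕ_ (∣W∣≡q^dim M dim-M) (∣W∣≡q^dim M′ dim-M′) ⟨
    ∣ M ∣ *ℕ ∣ M′ ∣            ≤⟨ ∣M∣*∣M′∣≤∣M∩M′∣*∣W∣ {M = M} {M′} {W} M⊆W M′⊆W ⟩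
    ∣ M ∩ M′ ∣ *ℕ ∣ W ∣        ≡⟨ cong₂ _*ℕ_ (∣W∣≡q^dim (M ∩ M′) dim-M∩M′) (∣W∣≡q^dim W dim-W) ⟩
    q ^ℕ c *ℕ q ^ℕ w           ≡⟨ ℕ.^-distribˡ-+-* q c w ⟨
    q ^ℕ (c +ℕ w)              ∎)
    where open ℕ.≤-Reasoning


module Duality (F : FiniteField) where

  open import Data.Nat using (suc; _≤_; _<_) renaming (_+_ to _+ℕ_; _*_ to _*ℕ_; _^_ to _^ℕ_; _∸_ to _∸ℕ_)
  import Data.Nat.Properties as ℕ
  open import Data.Fin using (Fin) renaming (zero to fzero; suc to fsuc)
  open import Data.Vec using ([]; _∷_; lookup; tabulate)
  open import Data.Vec.Properties using (lookup∘tabulate; lookup-zipWith; lookup-map; lookup-replicate)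
  open import Data.List using (length; allFin)
  open import Data.List.Relation.Unary.Any using (Any; any?)
  open import Data.List.Membership.Propositional using (_∈_; lose)
  open import Data.List.Membership.Propositional.Properties using (∈-allFin)
  open import Data.Product using (∃-syntax; _×_; _,_; proj₁; proj₂)
  open import Data.Unit using (⊤; tt)
  open import Function using (_∘_)
  open import Relation.Nullary using (¬_; Dec; yes; no; contradiction)
  open import Relation.Nullary.Decidable using (¬?; _×-dec_; decidable-stable)
  open import Relation.Binary.PropositionalEquality hiding ([_])

  open Counting
  open QNumbers
  open VectorSpace F

  open FiniteField F
  open Geometry F
  open import Algebra.Bundles using (CommutativeRing)
  open CommutativeRing field-ring
    using (+-identityˡ; +-identityʳ; -‿inverseˡ; -‿inverseʳ; ring; *-assoc; *-identityˡ; *-identityʳ;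
           zeroˡ; zeroʳ; distribˡ; distribʳ; +-commutativeSemigroup; *-commutativeSemigroup)
  open import Algebra.Properties.Ring ring using (-1*x≈-x)
  open import Algebra.Properties.CommutativeSemigroup +-commutativeSemigroup using () renaming (interchange to +-interchange)
  open import Algebra.Properties.CommutativeSemigroup *-commutativeSemigroup using (x∙yz≈y∙xz)

  dot : ∀ {n} → V n → V n → Carrier
  dot []      []      = 0#
  dot (x ∷ a) (y ∷ v) = (x * y) + dot a v

  dot-⊕ʳ : ∀ {n} (a u v : V n) → dot a (u ⊕ v) ≡ dot a u + dot a v
  dot-⊕ʳ [] [] [] = sym (+-identityˡ 0#)
  dot-⊕ʳ (x ∷ a) (y ∷ u) (z ∷ v) = trans (cong₂ _+_ (distribˡ x y z) (dot-⊕ʳ a u v)) (+-interchange _ _ _ _)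

  dot-⊕ˡ : ∀ {n} (a a′ v : V n) → dot (a ⊕ a′) v ≡ dot a v + dot a′ v
  dot-⊕ˡ [] [] [] = sym (+-identityˡ 0#)
  dot-⊕ˡ (x ∷ a) (x′ ∷ a′) (y ∷ v) = trans (cong₂ _+_ (distribʳ y x x′) (dot-⊕ˡ a a′ v)) (+-interchange _ _ _ _)

  dot-·ʳ : ∀ {n} (a : V n) c v → dot a (c · v) ≡ c * dot a v
  dot-·ʳ [] c [] = sym (zeroʳ c)
  dot-·ʳ (x ∷ a) c (y ∷ v) = trans (cong₂ _+_ (x∙yz≈y∙xz x c y) (dot-·ʳ a c v)) (sym (distribˡ c _ _))

  dot-·ˡ : ∀ {n} c (a v : V n) → dot (c · a) v ≡ c * dot a v
  dot-·ˡ c [] [] = sym (zeroʳ c)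
  dot-·ˡ c (x ∷ a) (y ∷ v) = trans (cong₂ _+_ (*-assoc c x y) (dot-·ˡ c a v)) (sym (distribˡ c _ _))

  dot-0ʳ : ∀ {n} (a : V n) → dot a 0v ≡ 0#
  dot-0ʳ []      = refl
  dot-0ʳ (x ∷ a) = trans (cong₂ _+_ (zeroʳ x) (dot-0ʳ a)) (+-identityˡ 0#)

  dot-0ˡ : ∀ {n} (v : V n) → dot 0v v ≡ 0#
  dot-0ˡ []      = refl
  dot-0ˡ (y ∷ v) = trans (cong₂ _+_ (zeroˡ y) (dot-0ˡ v)) (+-identityˡ 0#)

  dot-nondegenerate : ∀ {n} (w : V n) → (∀ a → dot a w ≡ 0#) → w ≡ 0v
  dot-nondegenerate []      _    = refl
  dot-nondegenerate (x ∷ w) ⊥all = cong₂ _∷_ x≡0 (dot-nondegenerate w λ a →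
    trans (sym (trans (cong (_+ dot a w) (zeroˡ x)) (+-identityˡ _))) (⊥all (0# ∷ a)))
    where
    x≡0 : x ≡ 0#
    x≡0 = trans (sym (trans (cong₂ _+_ (*-identityˡ x) (dot-0ˡ w)) (+-identityʳ x))) (⊥all (1# ∷ 0v))

  dot-onto-1 : ∀ {n} (a : V n) → a ≢ 0v → ∃[ w ] dot a w ≡ 1#
  dot-onto-1 [] a≢0 = contradiction refl a≢0
  dot-onto-1 (x ∷ a) a≢0 with x ≟ 0#
  ... | no x≢0  = inv x x≢0 ∷ 0v , trans (cong₂ _+_ (⁻¹-inverseʳ x x≢0) (dot-0ʳ a)) (+-identityʳ 1#)
  ... | yes refl with w , a·w≡1 ← dot-onto-1 a (a≢0 ∘ cong (0# ∷_)) =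
    0# ∷ w , trans (cong₂ _+_ (zeroˡ 0#) a·w≡1) (+-identityˡ 1#)

  Ker : ∀ {n} → V n → Subspace n
  Ker a = record
    { mem = λ v → dot a v ≡ 0#
    ; dec = λ v → dot a v ≟ 0#
    ; 0∈  = dot-0ʳ a
    ; ⊕∈  = λ a⊥u a⊥v → trans (dot-⊕ʳ a _ _) (trans (cong₂ _+_ a⊥u a⊥v) (+-identityˡ 0#))
    ; ·∈  = λ c a⊥v → trans (dot-·ʳ a c _) (trans (cong (c *_) a⊥v) (zeroʳ c))
    }

  -- Vectors double as linear functionals via dot, so annihilators are subspaces of the same space.
  Ann : ∀ {n} → Subspace n → Subspace n
  Ann {n} W = record
    { mem = λ a → W ⊆ Ker a
    ; dec = λ a → W ⊆? Ker a
    ; 0∈  = λ {v} _ → dot-0ˡ v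
    ; ⊕∈  = λ {a} {a′} W⊆a W⊆a′ {v} v∈W →
              trans (dot-⊕ˡ a a′ v) (trans (cong₂ _+_ (W⊆a v∈W) (W⊆a′ v∈W)) (+-identityˡ 0#))
    ; ·∈  = λ c {a} W⊆a {v} v∈W → trans (dot-·ˡ c a v) (trans (cong (c *_) (W⊆a v∈W)) (zeroʳ c))
    }

  ⊥basis⇒⊆Ker : ∀ {n m} {W : Subspace n} {a} (dim-W : HasDim W m) → (∀ j → dot a (proj₁ dim-W j) ≡ 0#) → W ⊆ Ker a
  ⊥basis⇒⊆Ker {a = a} (b , _ , _ , b-spanning) a⊥b v∈W =
    let (c , v≡) = b-spanning _ v∈W in trans (cong (dot a) v≡) (lincomb-∈ (Ker a) c a⊥b)

  evalOn : ∀ {n m} → (Fin m → V n) → V n → V m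
  evalOn b a = tabulate (λ j → dot a (b j))

  evalOn-≡ : ∀ {n m} (b : Fin m → V n) {a a′} → evalOn b a ≡ evalOn b a′ → ∀ j → dot a (b j) ≡ dot a′ (b j)
  evalOn-≡ b eq j = trans (sym (lookup∘tabulate _ j)) (trans (cong (λ y → lookup y j) eq) (lookup∘tabulate _ j))

  evalOn-⊕ : ∀ {n m} (b : Fin m → V n) a a′ → evalOn b (a ⊕ a′) ≡ evalOn b a ⊕ evalOn b a′
  evalOn-⊕ b a a′ = lookup-ext λ j → begin
    lookup (evalOn b (a ⊕ a′)) j                    ≡⟨ lookup∘tabulate _ j ⟩
    dot (a ⊕ a′) (b j)                              ≡⟨ dot-⊕ˡ a a′ (b j) ⟩
    dot a (b j) + dot a′ (b j)                      ≡⟨ cong₂ _+_ (lookup∘tabulate _ j) (lookup∘tabulate _ j) ⟨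
    lookup (evalOn b a) j + lookup (evalOn b a′) j  ≡⟨ lookup-zipWith _+_ j (evalOn b a) (evalOn b a′) ⟨
    lookup (evalOn b a ⊕ evalOn b a′) j             ∎
    where open ≡-Reasoning

  evalOn-· : ∀ {n m} (b : Fin m → V n) c a → evalOn b (c · a) ≡ c · evalOn b a
  evalOn-· b c a = lookup-ext λ j → begin
    lookup (evalOn b (c · a)) j     ≡⟨ lookup∘tabulate _ j ⟩
    dot (c · a) (b j)               ≡⟨ dot-·ˡ c a (b j) ⟩
    c * dot a (b j)                 ≡⟨ cong (c *_) (lookup∘tabulate _ j) ⟨
    c * lookup (evalOn b a) j       ≡⟨ lookup-map j (c *_) (evalOn b a) ⟨
    lookup (c · evalOn b a) j       ∎
    where open ≡-Reasoning

  evalOn-⊥ : ∀ {n m} (b : Fin m → V n) {a} → (∀ j → dot a (b j) ≡ 0#) → evalOn b a ≡ 0v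
  evalOn-⊥ b a⊥b = lookup-ext λ j → trans (lookup∘tabulate _ j) (trans (a⊥b j) (sym (lookup-replicate j 0#)))

  dot-evalOn : ∀ {n m} (c : V m) (a : V n) (b : Fin m → V n) → dot c (evalOn b a) ≡ dot a (lincomb (lookup c) b)
  dot-evalOn []      a b = sym (dot-0ʳ a)
  dot-evalOn (x ∷ c) a b = begin
    (x * dot a (b fzero)) + dot c (evalOn (b ∘ fsuc) a)           ≡⟨ cong (_ +_) (dot-evalOn c a (b ∘ fsuc)) ⟩
    (x * dot a (b fzero)) + dot a (lincomb (lookup c) (b ∘ fsuc))  ≡⟨ cong (_+ _) (dot-·ʳ a x (b fzero)) ⟨
    dot a (x · b fzero) + dot a (lincomb (lookup c) (b ∘ fsuc))    ≡⟨ dot-⊕ʳ a _ _ ⟨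
    dot a (lincomb (lookup (x ∷ c)) b)                             ∎
    where open ≡-Reasoning

  ∃-nonzero-⊥ : ∀ {n m} (b : Fin m → V n) → m < n → ∃[ a ] a ≢ 0v × (∀ j → dot a (b j) ≡ 0#)
  ∃-nonzero-⊥ {n} {m} b m<n with ∃? (vectors n) (λ a → ¬? (a ≟ᵛ 0v) ×-dec ∀? (fins m) (λ j → dot a (b j) ≟ 0#))
  ... | yes found = found
  ... | no ∄      = contradiction (injective⇒≤ (evalOn b) evalOn-injective) (ℕ.<⇒≱ m<n)
    where
    evalOn-injective : ∀ {a a′} → evalOn b a ≡ evalOn b a′ → a ≡ a′
    evalOn-injective {a} {a′} eq with (a ⊖ a′) ≟ᵛ 0v
    ... | yes a⊖a′≡0 = x⊖y≡0⇒x≡y a a′ a⊖a′≡0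
    ... | no a⊖a′≢0  = contradiction (a ⊖ a′ , a⊖a′≢0 , λ j → begin
      dot (a ⊕ neg a′) (b j)                  ≡⟨ dot-⊕ˡ a (neg a′) (b j) ⟩
      dot a (b j) + dot (neg a′) (b j)
        ≡⟨ cong₂ _+_ (evalOn-≡ b {a} {a′} eq j) (trans (dot-·ˡ (- 1#) a′ (b j)) (-1*x≈-x _)) ⟩
      dot a′ (b j) + (- dot a′ (b j))         ≡⟨ -‿inverseʳ _ ⟩
      0#                                      ∎) ∄
      where open ≡-Reasoning

  evalOn-image : ∀ {n m} → (Fin m → V n) → Subspace m
  evalOn-image {n} b = record
    { mem = λ y → ∃[ a ] evalOn b a ≡ y
    ; dec = λ y → ∃? (vectors n) (λ a → evalOn b a ≟ᵛ y)
    ; 0∈  = 0v , evalOn-⊥ b {0v} (dot-0ˡ ∘ b)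
    ; ⊕∈  = λ { (a , refl) (a′ , refl) → a ⊕ a′ , evalOn-⊕ b a a′ }
    ; ·∈  = λ { c (a , refl) → c · a , evalOn-· b c a }
    }

  -- Row rank equals column rank: if evalOn b missed a vector, its image would have dimension < m, and a
  -- nonzero c orthogonal to that image would give the dependence lincomb c b = 0.
  evalOn-surjective : ∀ {n m} {b : Fin m → V n} → LinIndep b → ∀ y → ∃[ a ] evalOn b a ≡ y
  evalOn-surjective {n} {m} {b} independent y with basis-exists (evalOn-image b)
  ... | p , dim-image@(e , e∈image , e-independent , e-spanning) =
    count≥length⇒all (dec (evalOn-image b)) (allVecs m) image-full (complete (vectors m) y)
    where
    ¬p<m : ¬ p < m
    ¬p<m p<m = let (c , c≢0 , c⊥e) = ∃-nonzero-⊥ e p<m in c≢0 (lookup-ext λ i →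
      trans (lincomb-injective independent (trans (lincomb-⊥ c c⊥e) (sym (lincomb-zero b))) i) (sym (lookup-replicate i 0#)))
      where
      lincomb-⊥ : ∀ c → (∀ j → dot c (e j) ≡ 0#) → lincomb (lookup c) b ≡ 0v
      lincomb-⊥ c c⊥e = dot-nondegenerate _ λ a →
        let (d , image≡) = e-spanning (evalOn b a) (a , refl) in
        trans (sym (dot-evalOn c a b)) (trans (cong (dot c) image≡) (lincomb-∈ (Ker c) d c⊥e))
    image-full : length (allVecs m) ≤ ∣ evalOn-image b ∣
    image-full = ℕ.≤-reflexive (begin
      length (allVecs m)     ≡⟨ length-allVecs m ⟩
      q ^ℕ m                 ≡⟨ cong (q ^ℕ_) (ℕ.≤-antisym (independent⇒≤ e-independent) (ℕ.≮⇒≥ ¬p<m)) ⟨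
      q ^ℕ p                 ≡⟨ ∣W∣≡q^dim (evalOn-image b) dim-image ⟨
      ∣ evalOn-image b ∣     ∎)
      where open ≡-Reasoning

  -- A section σ of evalOn b turns (z , y) ↦ z ⊕ σ y into an injection Ann W × V m → V n.
  ∣Ann∣≤q^k : ∀ {n m k} {W : Subspace n} → HasDim W m → n ≡ k +ℕ m → ∣ Ann W ∣ ≤ q ^ℕ k
  ∣Ann∣≤q^k {n} {m} {k} {W} (b , b∈W , independent , _) n≡k+m = ℕ.*-cancelʳ-≤ _ _ (q ^ℕ m) {{ℕ.m^n≢0 q m}} (begin
    ∣ Ann W ∣ *ℕ q ^ℕ m
      ≡⟨ cong (∣ Ann W ∣ *ℕ_) (∣⊤ˢ∣≡q^n m) ⟨
    ∣ Ann W ∣ *ℕ ∣ ⊤ˢ {m} ∣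
      ≡⟨ count-cartesianProduct (dec (Ann W)) (dec ⊤ˢ) (allVecs n) (allVecs m) ⟨
    count (dec (Ann W) ⊗? dec ⊤ˢ) (list (vectors n ×ᴱ vectors m))
      ≤⟨ injection⇒count≤ _ (dec ⊤ˢ) (vectors n) (unique (vectors n ×ᴱ vectors m)) f (λ _ → tt) f-injective ⟩
    ∣ ⊤ˢ {n} ∣          ≡⟨ ∣⊤ˢ∣≡q^n n ⟩
    q ^ℕ n              ≡⟨ cong (q ^ℕ_) n≡k+m ⟩
    q ^ℕ (k +ℕ m)       ≡⟨ ℕ.^-distribˡ-+-* q k m ⟩
    q ^ℕ k *ℕ q ^ℕ m    ∎)
    where
    open ℕ.≤-Reasoning
    σ : V m → V n
    σ y = proj₁ (evalOn-surjective independent y)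
    f : V n × V m → V n
    f (z , y) = z ⊕ σ y
    evalOn-f : ∀ {z} → mem (Ann W) z → ∀ y → evalOn b (f (z , y)) ≡ y
    evalOn-f {z} z∈Ann y = trans (evalOn-⊕ b z (σ y))
      (trans (cong₂ _⊕_ (evalOn-⊥ b {z} (z∈Ann ∘ b∈W)) (proj₂ (evalOn-surjective independent y))) (⊕-identityˡ y))
    f-injective : InjectiveOn (λ (z , _) → mem (Ann W) z × ⊤) f
    f-injective {z , y} {z′ , y′} (z∈Ann , _) (z′∈Ann , _) eq =
      let y≡y′ = trans (sym (evalOn-f {z} z∈Ann y)) (trans (cong (evalOn b) eq) (evalOn-f {z′} z′∈Ann y′)) in
      cong₂ _,_ (⊕-cancelʳ (σ y) z z′ (trans eq (cong (λ y → z′ ⊕ σ y) (sym y≡y′)))) y≡y′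

  #points-Ann≤[k] : ∀ {n m k} {W : Subspace n} → HasDim W m → n ≡ k +ℕ m → #points (dec (Ann W)) ≤ [ k ] q
  #points-Ann≤[k] {k = k} {W} dim-W n≡k+m = ∣W∣≤q^m⇒#points≤[m] {m = k} (Ann W) (∣Ann∣≤q^k {W = W} dim-W n≡k+m)

  q*∣Ker∣≡q^n : ∀ {n} {a : V n} → a ≢ 0v → q *ℕ ∣ Ker a ∣ ≡ q ^ℕ n
  q*∣Ker∣≡q^n {n} {a} a≢0 = begin
    q *ℕ ∣ Ker a ∣
      ≡⟨ ∣F×W∣≡q*∣W∣ (Ker a) ⟨
    count ((λ _ → yes tt) ⊗? dec (Ker a)) (list (scalars ×ᴱ vectors n))
      ≡⟨ bijection⇒count≡ _ (dec ⊤ˢ) (scalars ×ᴱ vectors n) (vectors n) f (λ _ → tt) f-injective f-onto ⟩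
    ∣ ⊤ˢ {n} ∣
      ≡⟨ ∣⊤ˢ∣≡q^n n ⟩
    q ^ℕ n
      ∎
    where
    open ≡-Reasoning
    w = proj₁ (dot-onto-1 a a≢0)
    a·cw≡c : ∀ c → dot a (c · w) ≡ c
    a·cw≡c c = trans (dot-·ʳ a c w) (trans (cong (c *_) (proj₂ (dot-onto-1 a a≢0))) (*-identityʳ c))
    f : Carrier × V n → V n
    f (c , z) = (c · w) ⊕ z
    dot-f : ∀ c {z} → dot a z ≡ 0# → dot a (f (c , z)) ≡ c
    dot-f c {z} a·z≡0 = trans (dot-⊕ʳ a _ z) (trans (cong₂ _+_ (a·cw≡c c) a·z≡0) (+-identityʳ c))
    f-injective : InjectiveOn (λ (_ , z) → ⊤ × dot a z ≡ 0#) f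
    f-injective {c , z} {c′ , z′} (_ , a·z≡0) (_ , a·z′≡0) eq =
      let c≡c′ = trans (sym (dot-f c a·z≡0)) (trans (cong (dot a) eq) (dot-f c′ a·z′≡0)) in
      cong₂ _,_ c≡c′ (⊕-cancelˡ (c · w) z z′ (trans eq (cong (λ c → (c · w) ⊕ z′) (sym c≡c′))))
    f-onto : SurjectiveOnto (λ (_ , z) → ⊤ × dot a z ≡ 0#) (λ _ → ⊤) f
    f-onto {v} _ = (c , neg (c · w) ⊕ v) , (tt , a·rest≡0) , ⊕-neg-cancelˡ (c · w) v
      where
      c = dot a v
      a·rest≡0 : dot a (neg (c · w) ⊕ v) ≡ 0#
      a·rest≡0 = trans (dot-⊕ʳ a _ v) (trans (cong (_+ c) (trans (dot-·ʳ a (- 1#) (c · w)) (cong ((- 1#) *_) (a·cw≡c c))))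
                                            (trans (cong (_+ c) (-1*x≈-x c)) (-‿inverseˡ c)))

  ker-isHyperplane : ∀ {n} {a : V n} → a ≢ 0v → IsHyperplane (Ker a)
  ker-isHyperplane {n} {a} a≢0 = let (d , dim-Ker) = basis-exists (Ker a) in
    subst (HasDim (Ker a)) (cong (_∸ℕ 1) (^-injectiveʳ q {suc d} {n} 1<q
      (trans (cong (q *ℕ_) (sym (∣W∣≡q^dim (Ker a) dim-Ker))) (q*∣Ker∣≡q^n a≢0)))) dim-Ker

  ∃-hyperplane⊇ : ∀ {n m} {W : Subspace n} → HasDim W m → m < n → ∃[ H ] IsHyperplane H × W ⊆ H
  ∃-hyperplane⊇ {W = W} dim-W@(b , _) m<n =
    let (a , a≢0 , a⊥b) = ∃-nonzero-⊥ b m<n in Ker a , ker-isHyperplane a≢0 , ⊥basis⇒⊆Ker {W = W} {a} dim-W a⊥b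

  -- The hyperplane Ker a contains W exactly when a ∈ Ann W, so if every hyperplane contained some S i,
  -- the [ n ] points would be covered by the annihilators, which have at most [ k ] points each.
  ∃-hyperplane⊉ : ∀ {n m k s} (S : Fin s → Subspace n) → (∀ i → HasDim (S i) m) → n ≡ k +ℕ m →
                  s *ℕ [ k ] q < [ n ] q → ∃[ H ] IsHyperplane H × (∀ i → ¬ S i ⊆ H)
  ∃-hyperplane⊉ {n} {m} {k} {s} S dim-S n≡k+m s[k]<[n]
    with ∃? (vectors n) (λ a → normalised? a ×-dec ∀? (fins s) (λ i → ¬? (S i ⊆? Ker a)))
  ... | yes (a , normalised-a , avoids) = Ker a , ker-isHyperplane (normalised⇒≢0 normalised-a) , avoids
  ... | no ∄ = contradiction [n]≤s[k] (ℕ.<⇒≱ s[k]<[n])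
    where
    open ℕ.≤-Reasoning
    R? : ∀ i a → Dec (Normalised a × mem (Ann (S i)) a)
    R? i a = normalised? a ×-dec dec (Ann (S i)) a
    covered : ∀ {a} → a ∈ allVecs n → Normalised a × ⊤ → Any (λ i → Normalised a × mem (Ann (S i)) a) (allFin s)
    covered {a} _ (normalised-a , _) = decidable-stable (any? (λ i → R? i a) (allFin s)) λ ¬any →
      ∄ (a , normalised-a , λ i S⊆Ker → ¬any (lose (∈-allFin i) (normalised-a , S⊆Ker)))
    [n]≤s[k] : [ n ] q ≤ s *ℕ [ k ] q
    [n]≤s[k] = begin
      [ n ] q                                                    ≡⟨ #points-⊤ˢ n ⟨
      #points (dec (⊤ˢ {n}))
        ≤⟨ count-mono _ (λ a → any? (λ i → R? i a) (allFin s)) (allVecs n) covered ⟩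
      count (λ a → any? (λ i → R? i a) (allFin s)) (allVecs n)
        ≤⟨ count-any≤∑ R? (allFin s) (allVecs n) ⟩
      ∑[ i ∈ allFin s ] #points (dec (Ann (S i)))
        ≤⟨ ∑-mono (allFin s) (λ {i} _ → #points-Ann≤[k] {W = S i} (dim-S i) n≡k+m) ⟩
      ∑[ i ∈ allFin s ] [ k ] q                                 ≡⟨ ∑-const ([ k ] q) (allFin s) ⟩
      length (allFin s) *ℕ [ k ] q                               ≡⟨ cong (_*ℕ [ k ] q) (length-allFin s) ⟩
      s *ℕ [ k ] q                                               ∎


module Theorem (F : FiniteField) where

  open import Data.Nat using (ℕ; suc; _+_; _*_; _∸_; _^_; _≤_; _<_; z≤n; s≤s; NonZero; >-nonZero; ≢-nonZero⁻¹)
  open import Data.Nat.Properties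
  open import Data.Nat.Tactic.RingSolver using (solve-∀)
  open import Data.Fin as Fin using (Fin)
  open import Data.List using (allFin; length)
  open import Data.List.Membership.Propositional using (_∈_)
  open import Data.List.Membership.Propositional.Properties using (∈-allFin)
  open import Data.Product using (Σ-syntax; ∃-syntax; _×_; _,_; proj₁; proj₂)
  open import Data.Sum using (_⊎_; inj₁; inj₂)
  open import Data.Unit using (tt)
  open import Relation.Nullary using (¬_; Dec; yes; no; contradiction)
  open import Relation.Nullary.Decidable using (_×-dec_)
  open import Relation.Unary using (Decidable)
  open import Relation.Binary.PropositionalEquality hiding ([_])

  open Counting
  open QNumbers
  open VectorSpace F
  open Duality F

  open FiniteField F using (0#)
  open Geometry F

  mult-· : ∀ {n s} (S : Fin s → Subspace n) {c} (u : V n) → c ≢ 0# → mult S (c · u) ≡ mult S u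
  mult-· S {c} u c≢0 = count-cong _ _ (allFin _)
    (λ {i} _ cu∈S → subst (mem (S i)) (·-inverseˡ c c≢0 u) (·∈ (S i) (inv c c≢0) cu∈S))
    (λ {i} _ u∈S → ·∈ (S i) c u∈S)

  ∑#points[S∩W]≡d*#points[Y∩W] : ∀ {n s d} (S : Fin s → Subspace n) →
    (∀ (v : V n) → v ≢ 0v → mult S v ≡ 0 ⊎ mult S v ≡ d) → ∀ {W : V n → Set} (W? : Decidable W) →
    ∑[ i ∈ allFin s ] #points (λ v → dec (S i) v ×-dec W? v) ≡ d * #points (λ v → InY? S d v ×-dec W? v)
  ∑#points[S∩W]≡d*#points[Y∩W] {n} {s} {d} S mult∈0d {W} W? = begin
    ∑[ i ∈ allFin s ] count (λ v → R? i v) (allVecs n)            ≡⟨ ∑-count-swap R? (allFin s) (allVecs n) ⟩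
    ∑[ v ∈ allVecs n ] count (λ i → R? i v) (allFin s)            ≡⟨ ∑-cong (allVecs n) (λ {v} _ → incidences v) ⟩
    ∑[ v ∈ allVecs n ] (d * indicator (Y∩W? v))                   ≡⟨ ∑-*ˡ d (λ v → indicator (Y∩W? v)) (allVecs n) ⟩
    d * ∑[ v ∈ allVecs n ] indicator (Y∩W? v)                     ≡⟨ cong (d *_) (∑-indicator Y∩W? (allVecs n)) ⟩
    d * count Y∩W? (allVecs n)                                    ∎
    where
    open ≡-Reasoning
    R? : ∀ i v → Dec (Normalised v × mem (S i) v × W v)
    R? i v = normalised? v ×-dec (dec (S i) v ×-dec W? v)
    Y∩W? : ∀ v → Dec (Normalised v × InY S d v × W v)
    Y∩W? v = normalised? v ×-dec (InY? S d v ×-dec W? v)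
    incidences : ∀ v → count (λ i → R? i v) (allFin s) ≡ d * indicator (Y∩W? v)
    incidences v with normalised? v | W? v | InY? S d v
    ... | no ¬nv | _      | _         = trans (count-none _ (allFin s) λ _ (nv , _) → ¬nv nv) (sym (*-zeroʳ d))
    ... | yes _  | no ¬wv | yes _     = trans (count-none _ (allFin s) λ _ (_ , _ , wv) → ¬wv wv) (sym (*-zeroʳ d))
    ... | yes _  | no ¬wv | no _      = trans (count-none _ (allFin s) λ _ (_ , _ , wv) → ¬wv wv) (sym (*-zeroʳ d))
    ... | yes nv | yes wv | v∈Y?      =
      trans (count-cong _ (λ i → dec (S i) v) (allFin s) (λ _ (_ , v∈S , _) → v∈S) (λ _ v∈S → nv , v∈S , wv)) (mult≡ v∈Y?)
      where
      mult≡ : (v∈Y? : Dec (InY S d v)) → mult S v ≡ d * indicator (yes nv ×-dec (v∈Y? ×-dec yes wv))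
      mult≡ (yes mult≡d) = trans mult≡d (sym (*-identityʳ d))
      mult≡ (no mult≢d) with mult∈0d v (normalised⇒≢0 nv)
      ... | inj₁ mult≡0 = trans mult≡0 (sym (*-zeroʳ d))
      ... | inj₂ mult≡d = contradiction mult≡d mult≢d

  module Family {n k s d : ℕ} (1≤k : 1 ≤ k) (2k≤n : 2 * k ≤ n) (2≤s : 2 ≤ s) (2≤d : 2 ≤ d)
    (S : Fin s → Subspace n) (dim-S : ∀ i → HasDim (S i) (n ∸ k))
    (mult∈0d : ∀ (v : V n) → v ≢ 0v → mult S v ≡ 0 ⊎ mult S v ≡ d)
    (outside : Σ[ v ∈ V n ] (v ≢ 0v × mult S v ≡ 0))
    (inside : Σ[ v ∈ V n ] (v ≢ 0v × mult S v ≡ d))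
    (dim-S∩S : ∀ i j → i ≢ j → HasDim (S i ∩ S j) (n ∸ 2 * k)) where

    m = n ∸ 2 * k
    j = n ∸ k ∸ 1

    n≡k+[k+m] : n ≡ k + (k + m)
    n≡k+[k+m] = trans (sym (m∸n+n≡m 2k≤n)) (rearrange m k)
      where
      rearrange : ∀ m k → m + 2 * k ≡ k + (k + m)
      rearrange = solve-∀

    n∸k≡k+m : n ∸ k ≡ k + m
    n∸k≡k+m = trans (cong (_∸ k) n≡k+[k+m]) (m+n∸m≡n k (k + m))

    n≡k+[n∸k] : n ≡ k + (n ∸ k)
    n≡k+[n∸k] = trans n≡k+[k+m] (cong (k +_) (sym n∸k≡k+m))

    1≤n∸k : 1 ≤ n ∸ k
    1≤n∸k = subst (1 ≤_) (sym n∸k≡k+m) (≤-trans 1≤k (m≤m+n k m))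

    instance
      n∸k-nonZero : NonZero (n ∸ k)
      n∸k-nonZero = >-nonZero 1≤n∸k

      n-nonZero : NonZero n
      n-nonZero = >-nonZero (subst (1 ≤_) (sym n≡k+[n∸k]) (≤-trans 1≤k (m≤m+n k (n ∸ k))))

      s-nonZero : NonZero s
      s-nonZero = >-nonZero (≤-trans (s≤s z≤n) 2≤s)

      d-nonZero : NonZero d
      d-nonZero = >-nonZero (≤-trans (s≤s z≤n) 2≤d)

    n∸k<n : n ∸ k < n
    n∸k<n = subst (n ∸ k <_) (sym n≡k+[n∸k]) (m<n+m (n ∸ k) 1≤k)

    dim-S′ : ∀ i → HasDim (S i) (suc j)
    dim-S′ i = subst (HasDim (S i)) (sym (suc-pred (n ∸ k))) (dim-S i)

    Y? : ∀ v → Dec (InY S d v)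
    Y? = InY? S d

    N : ℕ
    N = #points Y?

    S⊆Y : ∀ i {v} → Normalised v → mem (S i) v → InY S d v
    S⊆Y i {v} normalised-v v∈S with mult∈0d v (normalised⇒≢0 normalised-v)
    ... | inj₂ mult≡d = mult≡d
    ... | inj₁ mult≡0 = contradiction (subst (1 ≤_) mult≡0 (1≤count (λ i → dec (S i) v) (∈-allFin i) v∈S)) λ ()

    normalised-representative : ∀ {t} → (Σ[ v ∈ V n ] (v ≢ 0v × mult S v ≡ t)) → Σ[ u ∈ V n ] (Normalised u × mult S u ≡ t)
    normalised-representative (v , v≢0 , mult≡t) = let (c , u , c≢0 , normalised-u , v≡cu) = normalise v v≢0 in
      u , normalised-u , trans (sym (mult-· S u c≢0)) (trans (cong (mult S) (sym v≡cu)) mult≡t)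

    Y-nonempty : Σ[ v ∈ V n ] (Normalised v × InY S d v)
    Y-nonempty = normalised-representative inside

    Y-proper : Σ[ v ∈ V n ] (Normalised v × ¬ InY S d v)
    Y-proper = let (u , normalised-u , mult≡0) = normalised-representative outside in
      u , normalised-u , λ mult≡d → ≢-nonZero⁻¹ d (trans (sym mult≡d) mult≡0)

    N<[n] : N < [ n ] q
    N<[n] = let (u , normalised-u , u∉Y) = Y-proper in subst (N <_) (#points-⊤ˢ n)
      (count-< (λ v → normalised? v ×-dec Y? v) (λ v → normalised? v ×-dec dec ⊤ˢ v) (allVecs n)
        (λ _ (nv , _) → nv , tt) (complete (vectors n) u) (normalised-u , tt) λ (_ , u∈Y) → u∉Y u∈Y)

    ∑#points[S∩W] : ∀ {W : V n → Set} (W? : Decidable W) →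
      ∑[ i ∈ allFin s ] #points (λ v → dec (S i) v ×-dec W? v) ≡ d * #points (λ v → Y? v ×-dec W? v)
    ∑#points[S∩W] = ∑#points[S∩W]≡d*#points[Y∩W] S mult∈0d

    d*N≡s*[n∸k] : d * N ≡ s * [ n ∸ k ] q
    d*N≡s*[n∸k] = begin
      d * N                                       ≡⟨ cong (d *_) (#points-cong Y? _ (λ _ v∈Y → v∈Y , tt) (λ _ → proj₁)) ⟩
      d * #points (λ v → Y? v ×-dec dec ⊤ˢ v)     ≡⟨ ∑#points[S∩W] (dec ⊤ˢ) ⟨
      ∑[ i ∈ allFin s ] #points (dec (S i ∩ ⊤ˢ))  ≡⟨ ∑-cong (allFin s) (λ {i} _ → #points-S∩⊤ i) ⟩
      ∑[ i ∈ allFin s ] [ n ∸ k ] q               ≡⟨ ∑-const ([ n ∸ k ] q) (allFin s) ⟩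
      length (allFin s) * [ n ∸ k ] q             ≡⟨ cong (_* [ n ∸ k ] q) (length-allFin s) ⟩
      s * [ n ∸ k ] q                             ∎
      where
      open ≡-Reasoning
      #points-S∩⊤ : ∀ i → #points (dec (S i ∩ ⊤ˢ)) ≡ [ n ∸ k ] q
      #points-S∩⊤ i = trans (#points-cong _ (dec (S i)) (λ _ → proj₁) (λ _ v∈S → v∈S , tt)) (#points-dim (S i) (dim-S i))

    #S⊆ : Subspace n → ℕ
    #S⊆ H = count (λ i → S i ⊆? H) (allFin s)

    #points[S∩H] : ∀ {H} → IsHyperplane H → ∀ i → #points (dec (S i ∩ H)) ≡ [ j ] q + indicator (S i ⊆? H) * q ^ j
    #points[S∩H] {H} isHyperplane i with S i ⊆? H
    ... | no S⊈H  = trans (#points-∩-hyperplane {M = S i} {H} (dim-S′ i) isHyperplane S⊈H) (sym (+-identityʳ _))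
    ... | yes S⊆H = begin
      #points (dec (S i ∩ H))      ≡⟨ #points-cong _ (dec (S i)) (λ _ → proj₁) (λ _ v∈S → v∈S , S⊆H v∈S) ⟩
      #points (dec (S i))           ≡⟨ #points-dim (S i) (dim-S′ i) ⟩
      q ^ j + [ j ] q               ≡⟨ +-comm (q ^ j) ([ j ] q) ⟩
      [ j ] q + q ^ j               ≡⟨ cong ([ j ] q +_) (*-identityˡ (q ^ j)) ⟨
      [ j ] q + 1 * q ^ j           ∎
      where open ≡-Reasoning

    d*#points[Y∩H] : ∀ {H} → IsHyperplane H → d * #points (λ v → Y? v ×-dec dec H v) ≡ s * [ j ] q + #S⊆ H * q ^ j
    d*#points[Y∩H] {H} isHyperplane = begin
      d * #points (λ v → Y? v ×-dec dec H v)
        ≡⟨ ∑#points[S∩W] (dec H) ⟨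
      ∑[ i ∈ allFin s ] #points (dec (S i ∩ H))
        ≡⟨ ∑-cong (allFin s) (λ {i} _ → #points[S∩H] isHyperplane i) ⟩
      ∑[ i ∈ allFin s ] ([ j ] q + indicator (S i ⊆? H) * q ^ j)
        ≡⟨ ∑-affine (λ i → S i ⊆? H) ([ j ] q) (q ^ j) (allFin s) ⟩
      length (allFin s) * [ j ] q + #S⊆ H * q ^ j
        ≡⟨ cong (λ t → t * [ j ] q + #S⊆ H * q ^ j) (length-allFin s) ⟩
      s * [ j ] q + #S⊆ H * q ^ j
        ∎
      where open ≡-Reasoning

    #S⊆≤1 : ∀ {H} → IsHyperplane H → #S⊆ H ≤ 1
    #S⊆≤1 {H} isHyperplane = count≤1 (λ i → S i ⊆? H) (unique (fins s)) at-most-one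
      where
      n-1 = n ∸ 1
      1+m+[n-1]≡[n∸k]+[n∸k] : suc (m + n-1) ≡ (n ∸ k) + (n ∸ k)
      1+m+[n-1]≡[n∸k]+[n∸k] = begin
        suc (m + n-1)             ≡⟨ +-suc m n-1 ⟨
        m + suc n-1               ≡⟨ cong (m +_) (suc-pred n) ⟩
        m + n                     ≡⟨ cong (m +_) n≡k+[k+m] ⟩
        m + (k + (k + m))         ≡⟨ rearrange m k ⟩
        (k + m) + (k + m)         ≡⟨ cong₂ _+_ n∸k≡k+m n∸k≡k+m ⟨
        (n ∸ k) + (n ∸ k)         ∎
        where
        open ≡-Reasoning
        rearrange : ∀ m k → m + (k + (k + m)) ≡ (k + m) + (k + m)
        rearrange = solve-∀
      at-most-one : ∀ {x y} → x ∈ allFin s → y ∈ allFin s → S x ⊆ H → S y ⊆ H → x ≡ y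
      at-most-one {x} {y} _ _ Sx⊆H Sy⊆H with x Fin.≟ y
      ... | yes x≡y = x≡y
      ... | no x≢y  = contradiction
        (dim-∩-bound {M = S x} {S y} {H} (dim-S x) (dim-S y) (dim-S∩S x y x≢y) isHyperplane Sx⊆H Sy⊆H)
        (<⇒≱ (≤-reflexive 1+m+[n-1]≡[n∸k]+[n∸k]))

    i₀ : Fin s
    i₀ = Fin.fromℕ< (≤-trans (s≤s z≤n) 2≤s)

    count[i≡i₀] : count (λ i → i Fin.≟ i₀) (allFin s) ≡ 1
    count[i≡i₀] = ≤-antisym (count≤1 _ (unique (fins s)) λ _ _ x≡i₀ y≡i₀ → trans x≡i₀ (sym y≡i₀))
                            (1≤count (λ i → i Fin.≟ i₀) (∈-allFin i₀) refl)

    hyperplane⊇S[i₀] : ∃[ H ] IsHyperplane H × S i₀ ⊆ H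
    hyperplane⊇S[i₀] = ∃-hyperplane⊇ {W = S i₀} (dim-S i₀) n∸k<n

    H₁ : Subspace n
    H₁ = proj₁ hyperplane⊇S[i₀]

    #S⊆H₁≡1 : #S⊆ H₁ ≡ 1
    #S⊆H₁≡1 = let (_ , isHyperplane , S⊆H₁) = hyperplane⊇S[i₀] in
      ≤-antisym (#S⊆≤1 isHyperplane) (1≤count (λ i → S i ⊆? H₁) (∈-allFin i₀) S⊆H₁)

    a = [ n ∸ k ] q
    c = [ m ] q

    a≡q^k*c+[k] : a ≡ q ^ k * c + [ k ] q
    a≡q^k*c+[k] = trans (cong (λ t → [ t ] q) n∸k≡k+m) ([m+a] q k m)

    [n]≡q^k*a+[k] : [ n ] q ≡ q ^ k * a + [ k ] q
    [n]≡q^k*a+[k] = trans (cong (λ t → [ t ] q) n≡k+[n∸k]) ([m+a] q k (n ∸ k))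

    -- Double count through S i₀: all its points lie in Y, it meets itself in a points and each other member in c.
    d*a≡a+[s∸1]*c : d * a ≡ a + (s ∸ 1) * c
    d*a≡a+[s∸1]*c = begin
      d * a
        ≡⟨ cong (d *_) #points[Y∩S₀] ⟨
      d * #points (λ v → Y? v ×-dec dec (S i₀) v)
        ≡⟨ ∑#points[S∩W] (dec (S i₀)) ⟨
      ∑[ i ∈ allFin s ] #points (dec (S i ∩ S i₀))
        ≡⟨ ∑-cong (allFin s) (λ {i} _ → #points[S∩S₀] i) ⟩
      ∑[ i ∈ allFin s ] (c + indicator (i Fin.≟ i₀) * e)
        ≡⟨ ∑-affine (λ i → i Fin.≟ i₀) c e (allFin s) ⟩
      length (allFin s) * c + count (λ i → i Fin.≟ i₀) (allFin s) * e
        ≡⟨ cong₂ (λ l t → l * c + t * e) (length-allFin s) count[i≡i₀] ⟩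
      s * c + 1 * e
        ≡⟨ cong (λ s → s * c + 1 * e) (suc-pred s) ⟨
      suc (s ∸ 1) * c + 1 * e
        ≡⟨ rearrange (s ∸ 1) c e ⟩
      (c + e) + (s ∸ 1) * c
        ≡⟨ cong (_+ (s ∸ 1) * c) a≡c+e ⟨
      a + (s ∸ 1) * c
        ∎
      where
      open ≡-Reasoning
      e = a ∸ c
      a≡c+e : a ≡ c + e
      a≡c+e = sym (m+[n∸m]≡n (subst (c ≤_) (sym a≡q^k*c+[k]) (≤-trans (m≤n*m c (q ^ k) {{m^n≢0 q k}}) (m≤m+n _ _))))
      rearrange : ∀ s′ c e → suc s′ * c + 1 * e ≡ (c + e) + s′ * c
      rearrange = solve-∀
      #points-S₀ : ∀ {P : V n → Set} (P? : Decidable P) → (∀ {v} → Normalised v → mem (S i₀) v → P v) →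
                   #points (λ v → P? v ×-dec dec (S i₀) v) ≡ a
      #points-S₀ P? S₀⇒P = trans (#points-cong _ (dec (S i₀)) (λ _ → proj₂) (λ nv v∈S → S₀⇒P nv v∈S , v∈S))
                                 (#points-dim (S i₀) (dim-S i₀))
      #points[Y∩S₀] : #points (λ v → Y? v ×-dec dec (S i₀) v) ≡ a
      #points[Y∩S₀] = #points-S₀ Y? (S⊆Y i₀)
      #points[S∩S₀] : ∀ i → #points (dec (S i ∩ S i₀)) ≡ c + indicator (i Fin.≟ i₀) * e
      #points[S∩S₀] i with i Fin.≟ i₀
      ... | yes refl = trans (#points-S₀ (dec (S i₀)) λ _ v∈S → v∈S) (trans a≡c+e (cong (c +_) (sym (*-identityˡ e))))
      ... | no i≢i₀  = trans (#points-dim (S i ∩ S i₀) (dim-S∩S i i₀ i≢i₀)) (sym (+-identityʳ c))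

    s*[k]<[n] : s * [ k ] q < [ n ] q
    s*[k]<[n] = s*K<N {s = s} {d} (m^n>0 q k) ([m]>0 q 1≤k) a≡q^k*c+[k] [n]≡q^k*a+[k] d*a≡a+[s∸1]*c
      (subst (_< d * [ n ] q) d*N≡s*[n∸k] (*-monoʳ-< d N<[n]))

    hyperplane⊉S : ∃[ H ] IsHyperplane H × (∀ i → ¬ S i ⊆ H)
    hyperplane⊉S = ∃-hyperplane⊉ S dim-S n≡k+[n∸k] s*[k]<[n]

    H₀ : Subspace n
    H₀ = proj₁ hyperplane⊉S

    #S⊆H₀≡0 : #S⊆ H₀ ≡ 0
    #S⊆H₀≡0 = count-none (λ i → S i ⊆? H₀) (allFin s) λ {i} _ → proj₂ (proj₂ hyperplane⊉S) i

    #points[Y∩_] : Subspace n → ℕ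
    #points[Y∩ H ] = #points (λ v → Y? v ×-dec dec H v)

    same-#S⊆⇒same-#points : ∀ {H H′} → IsHyperplane H → IsHyperplane H′ → #S⊆ H ≡ #S⊆ H′ → #points[Y∩ H ] ≡ #points[Y∩ H′ ]
    same-#S⊆⇒same-#points isHyperplane isHyperplane′ #S⊆≡ = *-cancelˡ-≡ _ _ d
      (trans (d*#points[Y∩H] isHyperplane)
        (trans (cong (λ t → s * [ j ] q + t * q ^ j) #S⊆≡) (sym (d*#points[Y∩H] isHyperplane′))))

    h₁ h₂ : ℕ
    h₁ = #points[Y∩ H₁ ]
    h₂ = #points[Y∩ H₀ ]

    d*h₁≡[n∸k]+[s∸1]*[n∸k∸1] : d * h₁ ≡ [ n ∸ k ] q + (s ∸ 1) * [ n ∸ k ∸ 1 ] q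
    d*h₁≡[n∸k]+[s∸1]*[n∸k∸1] = begin
      d * h₁                               ≡⟨ d*#points[Y∩H] (proj₁ (proj₂ hyperplane⊇S[i₀])) ⟩
      s * [ j ] q + #S⊆ H₁ * q ^ j
                                           ≡⟨ cong₂ (λ s t → s * [ j ] q + t * q ^ j) (sym (suc-pred s)) #S⊆H₁≡1 ⟩
      suc (s ∸ 1) * [ j ] q + 1 * q ^ j    ≡⟨ rearrange (s ∸ 1) ([ j ] q) (q ^ j) ⟩
      [ suc j ] q + (s ∸ 1) * [ j ] q      ≡⟨ cong (λ t → [ t ] q + (s ∸ 1) * [ j ] q) (suc-pred (n ∸ k)) ⟩
      [ n ∸ k ] q + (s ∸ 1) * [ j ] q      ∎
      where
      open ≡-Reasoning
      rearrange : ∀ s′ J P → suc s′ * J + 1 * P ≡ (P + J) + s′ * J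
      rearrange = solve-∀

    d*h₂≡s*[n∸k∸1] : d * h₂ ≡ s * [ n ∸ k ∸ 1 ] q
    d*h₂≡s*[n∸k∸1] = trans (d*#points[Y∩H] (proj₁ (proj₂ hyperplane⊉S)))
                           (trans (cong (λ t → s * [ j ] q + t * q ^ j) #S⊆H₀≡0) (+-identityʳ _))

    #points[Y∩H]∈h₁,h₂ : ∀ H → IsHyperplane H → #points[Y∩ H ] ≡ h₁ ⊎ #points[Y∩ H ] ≡ h₂
    #points[Y∩H]∈h₁,h₂ H isHyperplane = by-#S⊆ (#S⊆ H) refl
      where
      by-#S⊆ : ∀ t → #S⊆ H ≡ t → #points[Y∩ H ] ≡ h₁ ⊎ #points[Y∩ H ] ≡ h₂
      by-#S⊆ 0 #S⊆≡0 = inj₂ (same-#S⊆⇒same-#points isHyperplane (proj₁ (proj₂ hyperplane⊉S)) (trans #S⊆≡0 (sym #S⊆H₀≡0)))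
      by-#S⊆ 1 #S⊆≡1 = inj₁ (same-#S⊆⇒same-#points isHyperplane (proj₁ (proj₂ hyperplane⊇S[i₀])) (trans #S⊆≡1 (sym #S⊆H₁≡1)))
      by-#S⊆ (suc (suc t)) #S⊆≡2+t = contradiction (subst (_≤ 1) #S⊆≡2+t (#S⊆≤1 isHyperplane)) λ { (s≤s ()) }

open import Data.Nat using (ℕ; _+_; _*_; _∸_; _≤_)
open import Data.Fin using (Fin)
open import Data.Product using (Σ-syntax; _×_; _,_)
open import Data.Sum using (_⊎_)
open import Relation.Binary.PropositionalEquality using (_≡_; _≢_; refl)

theorem5p5 : (F : FiniteField) → let open Geometry F in
  (n k s d : ℕ) → 1 ≤ k → 2 * k ≤ n → 2 ≤ s → 2 ≤ d →
  (S : Fin s → Subspace n) → (∀ i → HasDim (S i) (n ∸ k)) →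
  (∀ (v : V n) → v ≢ 0v → mult S v ≡ 0 ⊎ mult S v ≡ d) →
  (Σ[ v ∈ V n ] (v ≢ 0v × mult S v ≡ 0)) →
  (Σ[ v ∈ V n ] (v ≢ 0v × mult S v ≡ d)) →
  (∀ i j → i ≢ j → HasDim (S i ∩ S j) (n ∸ 2 * k)) →
  Σ[ N ∈ ℕ ] Σ[ h₁ ∈ ℕ ] Σ[ h₂ ∈ ℕ ]
    (d * N ≡ s * [ n ∸ k ] (FiniteField.order F) ×
     d * h₁ ≡ [ n ∸ k ] (FiniteField.order F) + (s ∸ 1) * [ n ∸ k ∸ 1 ] (FiniteField.order F) ×
     d * h₂ ≡ s * [ n ∸ k ∸ 1 ] (FiniteField.order F) ×
     IsProjectiveSet (InY? S d) N h₁ h₂)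
theorem5p5 F n k s d 1≤k 2k≤n 2≤s 2≤d S dim-S mult∈0d outside inside dim-S∩S =
  N , h₁ , h₂ , d*N≡s*[n∸k] , d*h₁≡[n∸k]+[s∸1]*[n∸k∸1] , d*h₂≡s*[n∸k∸1] ,
  Y-nonempty , Y-proper , refl , #points[Y∩H]∈h₁,h₂
  where open Theorem.Family F 1≤k 2k≤n 2≤s 2≤d S dim-S mult∈0d outside inside dim-S∩S
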